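{- For integers $n\ge 1$ and $k\ge 0$, let $t_{n,k}$ denote the number of strongly increasing Schröder trees with $n$ leaves and $k$ internal nodes. Then, as an identity of formal power series in $z$ with coefficients in $\mathbb{Q}(u)$, \[ \sum_{n\geq 1} \sum_{k=0}^{n-1} t_{n,k}\, u^k\, \frac{z^n}{n!} =\frac{u(1-zu)^{ -\frac{1}{u}} -u +z}{1+u}, \] where $(1-zu)^{ -1/u}$ denotes the formal power series $\exp\big(\sum_{m\ge1} u^{m-1} z^m/m\big)$.
   Context: A Schröder tree is a rooted plane tree (children of each node are ordered) in which every internal node has at least two children; its size is its number of leaves. A strongly increasing Schröder tree is a Schröder tree whose internal nodes carry labels such that, if there are $\ell$ internal nodes, the labels are exactly $1,\dots,\ell$, each used once, and labels strictly increase along every path from the root to a leaf. Leaves are unlabeled. The single leaf is the unique tree of size $1$ (with $0$ internal nodes). -}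

module Defs where

open import Data.Nat as ℕ using (ℕ; zero; suc; _≤_; _<_; _≟_; _!; _≤ᵇ_)
open import Data.Nat.Properties using (_!≢0)
open import Data.Bool using (Bool; true; false; if_then_else_)
open import Data.List using (List; []; _∷_; _++_; length; map; upTo)
open import Data.List.Relation.Unary.All using (All)
open import Data.Unit using (⊤)
open import Data.Product using (Σ; _×_)
open import Data.Fin using (Fin)
open import Relation.Binary.PropositionalEquality using (_≡_)
open import Relation.Nullary using (does)
open import Data.Integer using (+_)
open import Data.Rational using (ℚ; 0ℚ; 1ℚ; _+_; _*_; -_; _/_)

data Tree : Set where
  leaf : Tree
  node : ℕ → List Tree → Tree

mutual
  leaves : Tree → ℕ
  leaves leaf        = 1
  leaves (node _ cs) = leavesL cs

  leavesL : List Tree → ℕ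
  leavesL []       = 0
  leavesL (c ∷ cs) = leaves c ℕ.+ leavesL cs

mutual
  internals : Tree → ℕ
  internals leaf        = 0
  internals (node _ cs) = suc (internalsL cs)

  internalsL : List Tree → ℕ
  internalsL []       = 0
  internalsL (c ∷ cs) = internals c ℕ.+ internalsL cs

mutual
  labels : Tree → List ℕ
  labels leaf        = []
  labels (node a cs) = a ∷ labelsL cs

  labelsL : List Tree → List ℕ
  labelsL []       = []
  labelsL (c ∷ cs) = labels c ++ labelsL cs

mutual
  IsSchroeder : Tree → Set
  IsSchroeder leaf        = ⊤
  IsSchroeder (node _ cs) = 2 ≤ length cs × IsSchroederL cs

  IsSchroederL : List Tree → Set
  IsSchroederL []       = ⊤
  IsSchroederL (c ∷ cs) = IsSchroeder c × IsSchroederL cs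

mutual
  IncAbove : ℕ → Tree → Set
  IncAbove b leaf        = ⊤
  IncAbove b (node a cs) = b < a × IncAboveL a cs

  IncAboveL : ℕ → List Tree → Set
  IncAboveL b []       = ⊤
  IncAboveL b (c ∷ cs) = IncAbove b c × IncAboveL b cs

IsIncreasing : Tree → Set
IsIncreasing t = IncAbove 0 t

occ : ℕ → List ℕ → ℕ
occ x []       = 0
occ x (y ∷ ys) = if does (x ≟ y) then suc (occ x ys) else occ x ys

LabelsArePerm : Tree → Set
LabelsArePerm t =
  All (λ x → 1 ≤ x × x ≤ internals t) (labels t) ×
  All (λ i → occ i (labels t) ≡ 1) (map suc (upTo (internals t)))

StronglyIncreasingSchroeder : Tree → Set
StronglyIncreasingSchroeder t = IsSchroeder t × IsIncreasing t × LabelsArePerm t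

SIS : ℕ → ℕ → Set
SIS n k = Σ Tree (λ t → StronglyIncreasingSchroeder t × leaves t ≡ n × internals t ≡ k)

-- Formal power series in z with coefficients in ℚ[u], represented by
-- coefficient functions: F n k = [z^n u^k] F.

Series : Set
Series = ℕ → ℕ → ℚ

sumℚ : List ℚ → ℚ
sumℚ []       = 0ℚ
sumℚ (x ∷ xs) = x + sumℚ xs

Σ≤ : ℕ → (ℕ → ℚ) → ℚ
Σ≤ n f = sumℚ (map f (upTo (suc n)))

_⊕_ : Series → Series → Series
(F ⊕ G) n k = F n k + G n k

_⊖_ : Series → Series → Series
(F ⊖ G) n k = F n k + (- G n k)

_⊗_ : Series → Series → Series
(F ⊗ G) n k = Σ≤ n (λ i → Σ≤ k (λ j → F i j * G (n ℕ.∸ i) (k ℕ.∸ j)))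

δ : ℕ → ℕ → ℚ
δ a b = if does (a ≟ b) then 1ℚ else 0ℚ

oneS : Series
oneS n k = δ n 0 * δ k 0

uS : Series
uS n k = δ n 0 * δ k 1

zS : Series
zS n k = δ n 1 * δ k 0

_^S_ : Series → ℕ → Series
F ^S zero  = oneS
F ^S suc j = F ⊗ (F ^S j)

invFact : ℕ → ℚ
invFact j = (+ 1 / (j !)) {{j !≢0}}

-- exp of a series F with zero constant term in z: Σ_j F^j / j!.
-- Since F^j has no z^n term for j > n, the z^n-coefficient is the finite
-- sum over j ≤ n.
expS : Series → Series
expS F n k = Σ≤ n (λ j → invFact j * (F ^S j) n k)

logS : Series
logS zero    k = 0ℚ
logS (suc m) k = δ k m * ((+ 1 / suc m))

powS : Series
powS = expS logS

egf : (ℕ → ℕ → ℕ) → Series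
egf t zero    k = 0ℚ
egf t (suc m) k =
  if k ≤ᵇ m then ((+ t (suc m) k) / (suc m !)) {{suc m !≢0}} else 0ℚ

module Submission where

-- The node with the largest
-- label k + 1 has only leaf children; pruning it is a bijection onto
-- "grafting data" (a tree with k internal nodes, an arity c ≥ 2, a leaf
-- position), and splitting by c = 2 or c ≥ 3 gives
--     t (N + 1) (k + 1) = t N (k + 1) + N · t N k.
-- Analysis (FiniteSums, LogarithmPowers, BivariateSeries).  logS^j lives on
-- the diagonal n = k + j with profile lg^j, lg = log (1/(1 - z)); from
-- (1 - z) (lg^(j+1))′ = (j + 1) lg^j, n! [z^n u^k] (1 - zu)^(-1/u) is the
-- Stirling number stirling n (n - k).  Both t n (k + 1) + t n k and these
-- numbers obey one recurrence (Coefficients), which yields the theorem.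

open import Defs
open import Data.Nat using (ℕ)
open import Data.Fin using (Fin)
open import Function.Bundles using (_↔_)
open import Relation.Binary.PropositionalEquality using (_≡_)

module TreeSurgery where

  open import Data.Nat using (ℕ; zero; suc; _+_; _∸_; _≤_; _<_; s≤s; _≡ᵇ_; _<ᵇ_; z<s)
  open import Data.Nat.Properties
  open import Data.Bool using (Bool; true; false; T)
  open import Data.List using (List; []; _∷_; _++_; length; replicate)
  open import Data.List.Properties using (length-replicate)
  open import Data.List.Relation.Unary.All using (All; []; _∷_)
  open import Data.List.Relation.Unary.All.Properties using (++⁻ˡ; ++⁻ʳ)
  open import Data.Unit using (tt)
  open import Data.Empty using (⊥-elim)
  open import Data.Product using (_,_)
  open import Relation.Binary.PropositionalEquality
  open import Relation.Nullary using (¬_)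

  -- The tests x ≡ᵇ y and x <ᵇ y (to which the decision procedures used in
  -- Defs reduce) together with the fact they decide.
  data EqView (x y : ℕ) : Bool → Set where
    equal    : x ≡ y → EqView x y true
    distinct : ¬ x ≡ y → EqView x y false

  eqView : ∀ x y → EqView x y (x ≡ᵇ y)
  eqView x y with x ≡ᵇ y in e
  ... | true  = equal (≡ᵇ⇒≡ x y (subst T (sym e) tt))
  ... | false = distinct (λ x≡y → subst T e (≡⇒≡ᵇ x y x≡y))

  data LtView (x y : ℕ) : Bool → Set where
    less    : x < y → LtView x y true
    notLess : y ≤ x → LtView x y false

  ltView : ∀ x y → LtView x y (x <ᵇ y)
  ltView x y with x <ᵇ y in e
  ... | true  = less (<ᵇ⇒< x y (subst T (sym e) tt))
  ... | false = notLess (≮⇒≥ (λ x<y → subst T e (<⇒<ᵇ x<y)))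

  ∸-<-shift : ∀ {p a b} → a ≤ p → p < a + b → p ∸ a < b
  ∸-<-shift {p} {a} {b} a≤p p<a+b = subst (p ∸ a <_) (m+n∸m≡n a b) (∸-monoˡ-< p<a+b a≤p)

  occ-++ : ∀ x (xs ys : List ℕ) → occ x (xs ++ ys) ≡ occ x xs + occ x ys
  occ-++ x []       ys = refl
  occ-++ x (y ∷ xs) ys with x ≡ᵇ y
  ... | true  = cong suc (occ-++ x xs ys)
  ... | false = occ-++ x xs ys

  occ-outside : ∀ {P : ℕ → Set} x xs → All P xs → ¬ P x → occ x xs ≡ 0
  occ-outside x []       []          _  = refl
  occ-outside x (y ∷ ys) (py ∷ pys) ¬px with x ≡ᵇ y | eqView x y
  ... | true  | equal refl = ⊥-elim (¬px py)
  ... | false | distinct _ = occ-outside x ys pys ¬px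

  occ-absent : ∀ x xs → All (_< x) xs → occ x xs ≡ 0
  occ-absent x xs xs<x = occ-outside x xs xs<x (<-irrefl refl)

  occT : ℕ → Tree → ℕ
  occT x t = occ x (labels t)

  occF : ℕ → List Tree → ℕ
  occF x cs = occ x (labelsL cs)

  occF-∷ : ∀ x c cs → occF x (c ∷ cs) ≡ occT x c + occF x cs
  occF-∷ x c cs = occ-++ x (labels c) (labelsL cs)

  -- Kronecker delta on ℕ, in the form produced by occ.
  δℕ : ℕ → ℕ → ℕ
  δℕ x L = occ x (L ∷ [])

  δℕ-diag : ∀ L → δℕ L L ≡ 1
  δℕ-diag L with L ≡ᵇ L | eqView L L
  ... | true  | _            = refl
  ... | false | distinct L≢L = ⊥-elim (L≢L refl)

  leavesL-replicate : ∀ c → leavesL (replicate c leaf) ≡ c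
  leavesL-replicate zero    = refl
  leavesL-replicate (suc c) = cong suc (leavesL-replicate c)

  internalsL-replicate : ∀ c → internalsL (replicate c leaf) ≡ 0
  internalsL-replicate zero    = refl
  internalsL-replicate (suc c) = internalsL-replicate c

  labelsL-replicate : ∀ c → labelsL (replicate c leaf) ≡ []
  labelsL-replicate zero    = refl
  labelsL-replicate (suc c) = labelsL-replicate c

  schroederL-replicate : ∀ c → IsSchroederL (replicate c leaf)
  schroederL-replicate zero    = tt
  schroederL-replicate (suc c) = tt , schroederL-replicate c

  incAboveL-replicate : ∀ b c → IncAboveL b (replicate c leaf)
  incAboveL-replicate b zero    = tt
  incAboveL-replicate b (suc c) = tt , incAboveL-replicate b c

  -- Grafting: graft L c p t replaces the p-th leaf of t (counted from the
  -- left, starting at 0) by a node labelled L with c leaf children.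
  graftLeaf : ℕ → ℕ → ℕ → Tree
  graftLeaf L c zero    = node L (replicate c leaf)
  graftLeaf L c (suc p) = leaf

  mutual
    graft : ℕ → ℕ → ℕ → Tree → Tree
    graft L c p leaf        = graftLeaf L c p
    graft L c p (node a cs) = node a (graftF L c p cs)

    graftF : ℕ → ℕ → ℕ → List Tree → List Tree
    graftF L c p []       = []
    graftF L c p (x ∷ xs) with p <ᵇ leaves x
    ... | true  = graft L c p x ∷ xs
    ... | false = x ∷ graftF L c (p ∸ leaves x) xs

  -- Pruning, the inverse operation: prune L t replaces the subtree rooted at
  -- the node labelled L by a leaf; prunePos L t is the position of that leaf
  -- and pruneArity L t the number of children of the removed node.
  ifZero : {A : Set} → ℕ → A → A → A
  ifZero zero    a b = a
  ifZero (suc _) a b = b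

  mutual
    prune : ℕ → Tree → Tree
    prune L leaf        = leaf
    prune L (node a cs) with L ≡ᵇ a
    ... | true  = leaf
    ... | false = node a (pruneF L cs)

    pruneF : ℕ → List Tree → List Tree
    pruneF L []       = []
    pruneF L (c ∷ cs) = prune L c ∷ pruneF L cs

  mutual
    prunePos : ℕ → Tree → ℕ
    prunePos L leaf        = 0
    prunePos L (node a cs) with L ≡ᵇ a
    ... | true  = 0
    ... | false = prunePosF L cs

    prunePosF : ℕ → List Tree → ℕ
    prunePosF L []       = 0
    prunePosF L (c ∷ cs) = ifZero (occT L c) (leaves c + prunePosF L cs) (prunePos L c)

  mutual
    pruneArity : ℕ → Tree → ℕ
    pruneArity L leaf        = 0
    pruneArity L (node a cs) with L ≡ᵇ a
    ... | true  = length cs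
    ... | false = pruneArityF L cs

    pruneArityF : ℕ → List Tree → ℕ
    pruneArityF L []       = 0
    pruneArityF L (c ∷ cs) = ifZero (occT L c) (pruneArityF L cs) (pruneArity L c)

  mutual
    leaves-graft : ∀ L c p t → p < leaves t → suc (leaves (graft L c p t)) ≡ leaves t + c
    leaves-graft L c zero    leaf        _   = cong suc (leavesL-replicate c)
    leaves-graft L c (suc p) leaf        (s≤s ())
    leaves-graft L c p       (node a cs) p<n = leavesF-graft L c p cs p<n

    leavesF-graft : ∀ L c p cs → p < leavesL cs → suc (leavesL (graftF L c p cs)) ≡ leavesL cs + c
    leavesF-graft L c p (x ∷ xs) p<n with p <ᵇ leaves x | ltView p (leaves x)
    ... | true  | less p<x = begin
      suc (leaves (graft L c p x)) + leavesL xs ≡⟨ cong (_+ leavesL xs) (leaves-graft L c p x p<x) ⟩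
      leaves x + c + leavesL xs                 ≡⟨ +-assoc (leaves x) c (leavesL xs) ⟩
      leaves x + (c + leavesL xs)               ≡⟨ cong (leaves x +_) (+-comm c (leavesL xs)) ⟩
      leaves x + (leavesL xs + c)               ≡⟨ +-assoc (leaves x) (leavesL xs) c ⟨
      leaves x + leavesL xs + c                 ∎
      where open ≡-Reasoning
    ... | false | notLess x≤p = begin
      suc (leaves x + leavesL (graftF L c p′ xs)) ≡⟨ +-suc (leaves x) _ ⟨
      leaves x + suc (leavesL (graftF L c p′ xs)) ≡⟨ cong (leaves x +_) (leavesF-graft L c p′ xs (∸-<-shift x≤p p<n)) ⟩
      leaves x + (leavesL xs + c)                 ≡⟨ +-assoc (leaves x) (leavesL xs) c ⟨
      leaves x + leavesL xs + c                   ∎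
      where open ≡-Reasoning
            p′ = p ∸ leaves x

  mutual
    internals-graft : ∀ L c p t → p < leaves t → internals (graft L c p t) ≡ suc (internals t)
    internals-graft L c zero    leaf        _   = cong suc (internalsL-replicate c)
    internals-graft L c (suc p) leaf        (s≤s ())
    internals-graft L c p       (node a cs) p<n = cong suc (internalsF-graft L c p cs p<n)

    internalsF-graft : ∀ L c p cs → p < leavesL cs → internalsL (graftF L c p cs) ≡ suc (internalsL cs)
    internalsF-graft L c p (x ∷ xs) p<n with p <ᵇ leaves x | ltView p (leaves x)
    ... | true  | less p<x    = cong (_+ internalsL xs) (internals-graft L c p x p<x)
    ... | false | notLess x≤p =
      trans (cong (internals x +_) (internalsF-graft L c (p ∸ leaves x) xs (∸-<-shift x≤p p<n)))
            (+-suc (internals x) _)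

  mutual
    occ-graft : ∀ x L c p t → p < leaves t → occT x (graft L c p t) ≡ δℕ x L + occT x t
    occ-graft x L c zero    leaf        _   with x ≡ᵇ L
    ... | true  = cong suc (cong (occ x) (labelsL-replicate c))
    ... | false = cong (occ x) (labelsL-replicate c)
    occ-graft x L c (suc p) leaf        (s≤s ())
    occ-graft x L c p       (node a cs) p<n with x ≡ᵇ a
    ... | true  = trans (cong suc (occF-graft x L c p cs p<n)) (sym (+-suc (δℕ x L) _))
    ... | false = occF-graft x L c p cs p<n

    occF-graft : ∀ x L c p cs → p < leavesL cs → occF x (graftF L c p cs) ≡ δℕ x L + occF x cs
    occF-graft x L c p (y ∷ ys) p<n with p <ᵇ leaves y | ltView p (leaves y)
    ... | true  | less p<y = begin
      occF x (graft L c p y ∷ ys)       ≡⟨ occF-∷ x (graft L c p y) ys ⟩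
      occT x (graft L c p y) + occF x ys ≡⟨ cong (_+ occF x ys) (occ-graft x L c p y p<y) ⟩
      δℕ x L + occT x y + occF x ys      ≡⟨ +-assoc (δℕ x L) _ _ ⟩
      δℕ x L + (occT x y + occF x ys)    ≡⟨ cong (δℕ x L +_) (occF-∷ x y ys) ⟨
      δℕ x L + occF x (y ∷ ys)           ∎
      where open ≡-Reasoning
    ... | false | notLess y≤p = begin
      occF x (y ∷ graftF L c p′ ys)       ≡⟨ occF-∷ x y (graftF L c p′ ys) ⟩
      occT x y + occF x (graftF L c p′ ys) ≡⟨ cong (occT x y +_) (occF-graft x L c p′ ys (∸-<-shift y≤p p<n)) ⟩
      occT x y + (δℕ x L + occF x ys)      ≡⟨ +-comm (occT x y) _ ⟩
      δℕ x L + occF x ys + occT x y        ≡⟨ +-assoc (δℕ x L) _ _ ⟩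
      δℕ x L + (occF x ys + occT x y)      ≡⟨ cong (δℕ x L +_) (trans (+-comm _ (occT x y)) (sym (occF-∷ x y ys))) ⟩
      δℕ x L + occF x (y ∷ ys)             ∎
      where open ≡-Reasoning
            p′ = p ∸ leaves y

  occ-graft-self : ∀ L c p t → p < leaves t → occT L (graft L c p t) ≡ suc (occT L t)
  occ-graft-self L c p t p<n = trans (occ-graft L L c p t p<n) (cong (_+ occT L t) (δℕ-diag L))

  length-graftF : ∀ L c p cs → length (graftF L c p cs) ≡ length cs
  length-graftF L c p []       = refl
  length-graftF L c p (x ∷ xs) with p <ᵇ leaves x
  ... | true  = refl
  ... | false = cong suc (length-graftF L c (p ∸ leaves x) xs)

  mutual
    schroeder-graft : ∀ L c p t → 2 ≤ c → IsSchroeder t → IsSchroeder (graft L c p t)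
    schroeder-graft L c zero    leaf        2≤c _       = subst (2 ≤_) (sym (length-replicate c)) 2≤c , schroederL-replicate c
    schroeder-graft L c (suc p) leaf        2≤c _       = tt
    schroeder-graft L c p       (node a cs) 2≤c (2≤n , s) = subst (2 ≤_) (sym (length-graftF L c p cs)) 2≤n , schroederF-graft L c p cs 2≤c s

    schroederF-graft : ∀ L c p cs → 2 ≤ c → IsSchroederL cs → IsSchroederL (graftF L c p cs)
    schroederF-graft L c p []       2≤c _         = tt
    schroederF-graft L c p (x ∷ xs) 2≤c (sx , sxs) with p <ᵇ leaves x
    ... | true  = schroeder-graft L c p x 2≤c sx , sxs
    ... | false = sx , schroederF-graft L c (p ∸ leaves x) xs 2≤c sxs

  mutual
    incAbove-graft : ∀ L c p b t → b < L → All (_< L) (labels t) → IncAbove b t → IncAbove b (graft L c p t)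
    incAbove-graft L c zero    b leaf        b<L _            _          = b<L , incAboveL-replicate L c
    incAbove-graft L c (suc p) b leaf        b<L _            _          = tt
    incAbove-graft L c p       b (node a cs) b<L (a<L ∷ cs<L) (b<a , ics) = b<a , incAboveF-graft L c p a cs a<L cs<L ics

    incAboveF-graft : ∀ L c p b cs → b < L → All (_< L) (labelsL cs) → IncAboveL b cs → IncAboveL b (graftF L c p cs)
    incAboveF-graft L c p b []       b<L _  _          = tt
    incAboveF-graft L c p b (x ∷ xs) b<L <L (ix , ixs) with p <ᵇ leaves x
    ... | true  = incAbove-graft L c p b x b<L (++⁻ˡ (labels x) <L) ix , ixs
    ... | false = ix , incAboveF-graft L c (p ∸ leaves x) b xs b<L (++⁻ʳ (labels x) <L) ixs

  mutual
    prune-absent : ∀ L t → occT L t ≡ 0 → prune L t ≡ t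
    prune-absent L leaf        _  = refl
    prune-absent L (node a cs) no with L ≡ᵇ a
    ... | true  = ⊥-elim (1+n≢0 no)
    ... | false = cong (node a) (pruneF-absent L cs no)

    pruneF-absent : ∀ L cs → occF L cs ≡ 0 → pruneF L cs ≡ cs
    pruneF-absent L []       _  = refl
    pruneF-absent L (x ∷ xs) no = cong₂ _∷_ (prune-absent L x (m+n≡0⇒m≡0 _ no′)) (pruneF-absent L xs (m+n≡0⇒n≡0 (occT L x) no′))
      where no′ = trans (sym (occF-∷ L x xs)) no

  mutual
    prune-graft : ∀ L c p t → All (_< L) (labels t) → p < leaves t → prune L (graft L c p t) ≡ t
    prune-graft L c zero    leaf        _            _   with L ≡ᵇ L | eqView L L
    ... | true  | _            = refl
    ... | false | distinct L≢L = ⊥-elim (L≢L refl)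
    prune-graft L c (suc p) leaf        _            (s≤s ())
    prune-graft L c p       (node a cs) (a<L ∷ cs<L) p<n with L ≡ᵇ a | eqView L a
    ... | true  | equal refl = ⊥-elim (<-irrefl refl a<L)
    ... | false | _          = cong (node a) (pruneF-graft L c p cs cs<L p<n)

    pruneF-graft : ∀ L c p cs → All (_< L) (labelsL cs) → p < leavesL cs → pruneF L (graftF L c p cs) ≡ cs
    pruneF-graft L c p (x ∷ xs) <L p<n with p <ᵇ leaves x | ltView p (leaves x)
    ... | true  | less p<x =
      cong₂ _∷_ (prune-graft L c p x (++⁻ˡ (labels x) <L) p<x) (pruneF-absent L xs (occ-absent L _ (++⁻ʳ (labels x) <L)))
    ... | false | notLess x≤p =
      cong₂ _∷_ (prune-absent L x (occ-absent L _ (++⁻ˡ (labels x) <L)))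
                (pruneF-graft L c (p ∸ leaves x) xs (++⁻ʳ (labels x) <L) (∸-<-shift x≤p p<n))

  mutual
    prunePos-graft : ∀ L c p t → All (_< L) (labels t) → p < leaves t → prunePos L (graft L c p t) ≡ p
    prunePos-graft L c zero    leaf        _            _   with L ≡ᵇ L | eqView L L
    ... | true  | _            = refl
    ... | false | distinct L≢L = ⊥-elim (L≢L refl)
    prunePos-graft L c (suc p) leaf        _            (s≤s ())
    prunePos-graft L c p       (node a cs) (a<L ∷ cs<L) p<n with L ≡ᵇ a | eqView L a
    ... | true  | equal refl = ⊥-elim (<-irrefl refl a<L)
    ... | false | _          = prunePosF-graft L c p cs cs<L p<n

    prunePosF-graft : ∀ L c p cs → All (_< L) (labelsL cs) → p < leavesL cs → prunePosF L (graftF L c p cs) ≡ p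
    prunePosF-graft L c p (x ∷ xs) <L p<n with p <ᵇ leaves x | ltView p (leaves x)
    ... | true  | less p<x rewrite occ-graft-self L c p x p<x = prunePos-graft L c p x (++⁻ˡ (labels x) <L) p<x
    ... | false | notLess x≤p rewrite occ-absent L _ (++⁻ˡ (labels x) <L) =
      trans (cong (leaves x +_) (prunePosF-graft L c (p ∸ leaves x) xs (++⁻ʳ (labels x) <L) (∸-<-shift x≤p p<n)))
            (m+[n∸m]≡n x≤p)

  mutual
    pruneArity-graft : ∀ L c p t → All (_< L) (labels t) → p < leaves t → pruneArity L (graft L c p t) ≡ c
    pruneArity-graft L c zero    leaf        _            _   with L ≡ᵇ L | eqView L L
    ... | true  | _            = length-replicate c
    ... | false | distinct L≢L = ⊥-elim (L≢L refl)
    pruneArity-graft L c (suc p) leaf        _            (s≤s ())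
    pruneArity-graft L c p       (node a cs) (a<L ∷ cs<L) p<n with L ≡ᵇ a | eqView L a
    ... | true  | equal refl = ⊥-elim (<-irrefl refl a<L)
    ... | false | _          = pruneArityF-graft L c p cs cs<L p<n

    pruneArityF-graft : ∀ L c p cs → All (_< L) (labelsL cs) → p < leavesL cs → pruneArityF L (graftF L c p cs) ≡ c
    pruneArityF-graft L c p (x ∷ xs) <L p<n with p <ᵇ leaves x | ltView p (leaves x)
    ... | true  | less p<x rewrite occ-graft-self L c p x p<x = pruneArity-graft L c p x (++⁻ˡ (labels x) <L) p<x
    ... | false | notLess x≤p rewrite occ-absent L _ (++⁻ˡ (labels x) <L) =
      pruneArityF-graft L c (p ∸ leaves x) xs (++⁻ʳ (labels x) <L) (∸-<-shift x≤p p<n)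

  length-pruneF : ∀ L cs → length (pruneF L cs) ≡ length cs
  length-pruneF L []       = refl
  length-pruneF L (x ∷ xs) = cong suc (length-pruneF L xs)

  mutual
    schroeder-prune : ∀ L t → IsSchroeder t → IsSchroeder (prune L t)
    schroeder-prune L leaf        _         = tt
    schroeder-prune L (node a cs) (2≤n , s) with L ≡ᵇ a
    ... | true  = tt
    ... | false = subst (2 ≤_) (sym (length-pruneF L cs)) 2≤n , schroederF-prune L cs s

    schroederF-prune : ∀ L cs → IsSchroederL cs → IsSchroederL (pruneF L cs)
    schroederF-prune L []       _          = tt
    schroederF-prune L (x ∷ xs) (sx , sxs) = schroeder-prune L x sx , schroederF-prune L xs sxs

  mutual
    incAbove-prune : ∀ L b t → IncAbove b t → IncAbove b (prune L t)
    incAbove-prune L b leaf        _         = tt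
    incAbove-prune L b (node a cs) (b<a , i) with L ≡ᵇ a
    ... | true  = tt
    ... | false = b<a , incAboveF-prune L a cs i

    incAboveF-prune : ∀ L b cs → IncAboveL b cs → IncAboveL b (pruneF L cs)
    incAboveF-prune L b []       _          = tt
    incAboveF-prune L b (x ∷ xs) (ix , ixs) = incAbove-prune L b x ix , incAboveF-prune L b xs ixs

  leafChildren : ∀ L cs → IncAboveL L cs → All (_≤ L) (labelsL cs) → cs ≡ replicate (length cs) leaf
  leafChildren L []                _                _         = refl
  leafChildren L (leaf ∷ xs)       (_ , ixs)        ≤L        = cong (leaf ∷_) (leafChildren L xs ixs ≤L)
  leafChildren L (node a _ ∷ _)    ((L<a , _) , _)  (a≤L ∷ _) = ⊥-elim (<-irrefl refl (<-≤-trans L<a a≤L))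

  data SumIsOne (m n : ℕ) : Set where
    firstIsOne  : m ≡ 1 → n ≡ 0 → SumIsOne m n
    secondIsOne : m ≡ 0 → n ≡ 1 → SumIsOne m n

  sumIsOne : ∀ m n → m + n ≡ 1 → SumIsOne m n
  sumIsOne zero          n m+n≡1 = secondIsOne refl m+n≡1
  sumIsOne (suc zero)    n m+n≡1 = firstIsOne refl (suc-injective m+n≡1)
  sumIsOne (suc (suc m)) n ()

  data SumIsPositive (m n : ℕ) : Set where
    firstPositive  : 0 < m → SumIsPositive m n
    secondPositive : m ≡ 0 → 0 < n → SumIsPositive m n

  sumIsPositive : ∀ m n → 0 < m + n → SumIsPositive m n
  sumIsPositive zero    n 0<n = secondPositive refl 0<n
  sumIsPositive (suc m) n _   = firstPositive z<s

  occF-∷-one : ∀ L x xs → occF L (x ∷ xs) ≡ 1 → SumIsOne (occT L x) (occF L xs)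
  occF-∷-one L x xs one = sumIsOne (occT L x) (occF L xs) (trans (sym (occF-∷ L x xs)) one)

  occF-∷-positive : ∀ L x xs → 0 < occF L (x ∷ xs) → SumIsPositive (occT L x) (occF L xs)
  occF-∷-positive L x xs pos = sumIsPositive (occT L x) (occF L xs) (subst (0 <_) (occF-∷ L x xs) pos)

  mutual
    prunePos<leaves : ∀ L t → 0 < occT L t → prunePos L t < leaves (prune L t)
    prunePos<leaves L leaf        ()
    prunePos<leaves L (node a cs) pos with L ≡ᵇ a
    ... | true  = z<s
    ... | false = prunePosF<leaves L cs pos

    prunePosF<leaves : ∀ L cs → 0 < occF L cs → prunePosF L cs < leavesL (pruneF L cs)
    prunePosF<leaves L []       ()
    prunePosF<leaves L (x ∷ xs) pos with occF-∷-positive L x xs pos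
    ... | firstPositive px with occT L x in e | prunePos<leaves L x px
    ...   | suc _ | r = ≤-trans r (m≤m+n _ _)
    ...   | zero  | _ = ⊥-elim (<-irrefl (sym e) px)
    prunePosF<leaves L (x ∷ xs) pos | secondPositive e pxs rewrite e | prune-absent L x e =
      +-monoʳ-< (leaves x) (prunePosF<leaves L xs pxs)

  mutual
    2≤pruneArity : ∀ L t → IsSchroeder t → 0 < occT L t → 2 ≤ pruneArity L t
    2≤pruneArity L leaf        _         ()
    2≤pruneArity L (node a cs) (2≤n , s) pos with L ≡ᵇ a
    ... | true  = 2≤n
    ... | false = 2≤pruneArityF L cs s pos

    2≤pruneArityF : ∀ L cs → IsSchroederL cs → 0 < occF L cs → 2 ≤ pruneArityF L cs
    2≤pruneArityF L []       _          ()
    2≤pruneArityF L (x ∷ xs) (sx , sxs) pos with occF-∷-positive L x xs pos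
    ... | firstPositive px with occT L x in e | 2≤pruneArity L x sx px
    ...   | suc _ | r = r
    ...   | zero  | _ = ⊥-elim (<-irrefl (sym e) px)
    2≤pruneArityF L (x ∷ xs) (sx , sxs) pos | secondPositive e pxs rewrite e = 2≤pruneArityF L xs sxs pxs

  mutual
    graft-prune : ∀ L b t → IncAbove b t → All (_≤ L) (labels t) → occT L t ≡ 1 →
                  graft L (pruneArity L t) (prunePos L t) (prune L t) ≡ t
    graft-prune L b leaf        _         _            ()
    graft-prune L b (node a cs) (_ , ics) (a≤L ∷ cs≤L) one with L ≡ᵇ a | eqView L a
    ... | true  | equal refl = cong (node L) (sym (leafChildren L cs ics cs≤L))
    ... | false | _          = cong (node a) (graftF-pruneF L a cs ics cs≤L one)

    graftF-pruneF : ∀ L b cs → IncAboveL b cs → All (_≤ L) (labelsL cs) → occF L cs ≡ 1 →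
                    graftF L (pruneArityF L cs) (prunePosF L cs) (pruneF L cs) ≡ cs
    graftF-pruneF L b []       _          _  ()
    graftF-pruneF L b (x ∷ xs) (ix , ixs) ≤L one with occF-∷-one L x xs one
    ... | firstIsOne e1 e0 rewrite e1 | pruneF-absent L xs e0
        with prunePos L x <ᵇ leaves (prune L x) | ltView (prunePos L x) (leaves (prune L x))
    ...   | true  | _          = cong (_∷ xs) (graft-prune L b x ix (++⁻ˡ (labels x) ≤L) e1)
    ...   | false | notLess ge =
      ⊥-elim (<-irrefl refl (<-≤-trans (prunePos<leaves L x (subst (0 <_) (sym e1) z<s)) ge))
    graftF-pruneF L b (x ∷ xs) (ix , ixs) ≤L one | secondIsOne e0 e1 rewrite e0 | prune-absent L x e0
        with leaves x + prunePosF L xs <ᵇ leaves x | ltView (leaves x + prunePosF L xs) (leaves x)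
    ...   | true  | less lt = ⊥-elim (<-irrefl refl (<-≤-trans lt (m≤m+n _ _)))
    ...   | false | _ rewrite m+n∸m≡n (leaves x) (prunePosF L xs) =
      cong (x ∷_) (graftF-pruneF L b xs ixs (++⁻ʳ (labels x) ≤L) e1)

  mutual
    leaves-prune : ∀ L b t → IncAbove b t → All (_≤ L) (labels t) → occT L t ≡ 1 →
                   leaves (prune L t) + pruneArity L t ≡ suc (leaves t)
    leaves-prune L b leaf        _         _            ()
    leaves-prune L b (node a cs) (_ , ics) (a≤L ∷ cs≤L) one with L ≡ᵇ a | eqView L a
    ... | true  | equal refl = cong suc (sym (trans (cong leavesL (leafChildren L cs ics cs≤L)) (leavesL-replicate (length cs))))
    ... | false | _          = leavesF-pruneF L a cs ics cs≤L one

    leavesF-pruneF : ∀ L b cs → IncAboveL b cs → All (_≤ L) (labelsL cs) → occF L cs ≡ 1 →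
                     leavesL (pruneF L cs) + pruneArityF L cs ≡ suc (leavesL cs)
    leavesF-pruneF L b []       _          _  ()
    leavesF-pruneF L b (x ∷ xs) (ix , ixs) ≤L one with occF-∷-one L x xs one
    ... | firstIsOne e1 e0 rewrite e1 | pruneF-absent L xs e0 = begin
      leaves (prune L x) + leavesL xs + pruneArity L x   ≡⟨ +-assoc (leaves (prune L x)) _ _ ⟩
      leaves (prune L x) + (leavesL xs + pruneArity L x) ≡⟨ cong (leaves (prune L x) +_) (+-comm (leavesL xs) _) ⟩
      leaves (prune L x) + (pruneArity L x + leavesL xs) ≡⟨ +-assoc (leaves (prune L x)) _ _ ⟨
      leaves (prune L x) + pruneArity L x + leavesL xs   ≡⟨ cong (_+ leavesL xs) (leaves-prune L b x ix (++⁻ˡ (labels x) ≤L) e1) ⟩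
      suc (leaves x + leavesL xs)                        ∎
      where open ≡-Reasoning
    ... | secondIsOne e0 e1 rewrite e0 | prune-absent L x e0 = begin
      leaves x + leavesL (pruneF L xs) + pruneArityF L xs   ≡⟨ +-assoc (leaves x) _ _ ⟩
      leaves x + (leavesL (pruneF L xs) + pruneArityF L xs) ≡⟨ cong (leaves x +_) (leavesF-pruneF L b xs ixs (++⁻ʳ (labels x) ≤L) e1) ⟩
      leaves x + suc (leavesL xs)                           ≡⟨ +-suc (leaves x) _ ⟩
      suc (leaves x + leavesL xs)                           ∎
      where open ≡-Reasoning

  mutual
    internals-prune : ∀ L b t → IncAbove b t → All (_≤ L) (labels t) → occT L t ≡ 1 →
                      suc (internals (prune L t)) ≡ internals t
    internals-prune L b leaf        _         _            ()
    internals-prune L b (node a cs) (_ , ics) (a≤L ∷ cs≤L) one with L ≡ᵇ a | eqView L a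
    ... | true  | equal refl = cong suc (sym (trans (cong internalsL (leafChildren L cs ics cs≤L)) (internalsL-replicate (length cs))))
    ... | false | _          = cong suc (internalsF-pruneF L a cs ics cs≤L one)

    internalsF-pruneF : ∀ L b cs → IncAboveL b cs → All (_≤ L) (labelsL cs) → occF L cs ≡ 1 →
                        suc (internalsL (pruneF L cs)) ≡ internalsL cs
    internalsF-pruneF L b []       _          _  ()
    internalsF-pruneF L b (x ∷ xs) (ix , ixs) ≤L one with occF-∷-one L x xs one
    ... | firstIsOne e1 e0 rewrite pruneF-absent L xs e0 =
      cong (_+ internalsL xs) (internals-prune L b x ix (++⁻ˡ (labels x) ≤L) e1)
    ... | secondIsOne e0 e1 rewrite prune-absent L x e0 =
      trans (sym (+-suc (internals x) _)) (cong (internals x +_) (internalsF-pruneF L b xs ixs (++⁻ʳ (labels x) ≤L) e1))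

  mutual
    occ-prune : ∀ y L b t → IncAbove b t → All (_≤ L) (labels t) → occT L t ≡ 1 →
                δℕ y L + occT y (prune L t) ≡ occT y t
    occ-prune y L b leaf        _         _            ()
    occ-prune y L b (node a cs) (_ , ics) (a≤L ∷ cs≤L) one with L ≡ᵇ a | eqView L a
    ... | true  | equal refl rewrite trans (cong labelsL (leafChildren L cs ics cs≤L)) (labelsL-replicate (length cs))
        with y ≡ᵇ L
    ...   | true  = refl
    ...   | false = refl
    occ-prune y L b (node a cs) (_ , ics) (a≤L ∷ cs≤L) one | false | _ with y ≡ᵇ a
    ...   | true  = trans (+-suc (δℕ y L) _) (cong suc (occF-pruneF y L a cs ics cs≤L one))
    ...   | false = occF-pruneF y L a cs ics cs≤L one

    occF-pruneF : ∀ y L b cs → IncAboveL b cs → All (_≤ L) (labelsL cs) → occF L cs ≡ 1 →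
                  δℕ y L + occF y (pruneF L cs) ≡ occF y cs
    occF-pruneF y L b []       _          _  ()
    occF-pruneF y L b (x ∷ xs) (ix , ixs) ≤L one
      rewrite occF-∷ y (prune L x) (pruneF L xs) | occF-∷ y x xs with occF-∷-one L x xs one
    ... | firstIsOne e1 e0 rewrite pruneF-absent L xs e0 =
      trans (sym (+-assoc (δℕ y L) _ _)) (cong (_+ occF y xs) (occ-prune y L b x ix (++⁻ˡ (labels x) ≤L) e1))
    ... | secondIsOne e0 e1 rewrite prune-absent L x e0 = begin
      δℕ y L + (occT y x + occF y (pruneF L xs)) ≡⟨ +-assoc (δℕ y L) _ _ ⟨
      δℕ y L + occT y x + occF y (pruneF L xs)   ≡⟨ cong (_+ occF y (pruneF L xs)) (+-comm (δℕ y L) (occT y x)) ⟩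
      occT y x + δℕ y L + occF y (pruneF L xs)   ≡⟨ +-assoc (occT y x) _ _ ⟩
      occT y x + (δℕ y L + occF y (pruneF L xs)) ≡⟨ cong (occT y x +_) (occF-pruneF y L b xs ixs (++⁻ʳ (labels x) ≤L) e1) ⟩
      occT y x + occF y xs                       ∎
      where open ≡-Reasoning

module TreeCounting where

  open TreeSurgery
  open import Data.Nat using (ℕ; zero; suc; _+_; _*_; _≤_; _<_; z≤n; s≤s; z<s; _<ᵇ_; _≡ᵇ_)
  open import Data.Nat.Properties
  open import Data.Bool using (true; false; if_then_else_)
  open import Data.List using ([]; _∷_; map; upTo)
  open import Data.List.Relation.Unary.All as All using (All; [])
  open import Data.List.Membership.Propositional using (_∈_)
  open import Data.List.Membership.Propositional.Properties using (∈-map⁺; ∈-map⁻; ∈-upTo⁺; ∈-upTo⁻)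
  open import Data.List.Relation.Unary.Any using (here; there)
  open import Data.Unit using (tt)
  open import Data.Empty using (⊥; ⊥-elim)
  open import Data.Product using (_×_; _,_; proj₁)
  open import Data.Sum using (_⊎_; inj₁; inj₂)
  open import Data.Sum.Function.Propositional using (_⊎-↔_)
  open import Data.Product.Function.NonDependent.Propositional using (_×-↔_)
  open import Data.Fin using (Fin; zero; suc; toℕ; fromℕ<)
  open import Data.Fin.Properties using (toℕ-fromℕ<; fromℕ<-toℕ; toℕ<n; +↔⊎; *↔×)
  open import Data.Fin.Permutation using (↔⇒≡)
  open import Function.Bundles using (_↔_; mk↔ₛ′; Inverse)
  open import Function.Properties.Inverse using (↔-refl; ↔-sym; ↔-trans)
  open import Relation.Binary.PropositionalEquality
  open import Relation.Nullary using (Irrelevant)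

  -- The permutation condition on labels, as occurrence counts: a tree with ℓ
  -- internal nodes has its labels forming a permutation of 1, …, ℓ iff every
  -- x occurs inRange x ℓ times, where inRange x ℓ is 1 if 1 ≤ x ≤ ℓ, else 0.
  inRange : ℕ → ℕ → ℕ
  inRange zero    ℓ = 0
  inRange (suc y) ℓ = if y <ᵇ ℓ then 1 else 0

  LabelCount : Tree → Set
  LabelCount t = ∀ x → occT x t ≡ inRange x (internals t)

  inRange-suc : ∀ x ℓ → δℕ x (suc ℓ) + inRange x ℓ ≡ inRange x (suc ℓ)
  inRange-suc zero          ℓ       = refl
  inRange-suc (suc zero)    zero    = refl
  inRange-suc (suc zero)    (suc ℓ) = refl
  inRange-suc (suc (suc y)) zero    = refl
  inRange-suc (suc (suc y)) (suc ℓ) = inRange-suc (suc y) ℓ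

  inRange-positive : ∀ x ℓ → 0 < inRange x ℓ → 1 ≤ x × x ≤ ℓ
  inRange-positive zero    ℓ ()
  inRange-positive (suc y) ℓ pos with y <ᵇ ℓ | ltView y ℓ
  ... | true  | less y<ℓ = s≤s z≤n , y<ℓ
  ... | false | _        = ⊥-elim (<-irrefl refl pos)

  inRange-inside : ∀ y ℓ → y < ℓ → inRange (suc y) ℓ ≡ 1
  inRange-inside y ℓ y<ℓ with y <ᵇ ℓ | ltView y ℓ
  ... | true  | _           = refl
  ... | false | notLess ℓ≤y = ⊥-elim (<-irrefl refl (<-≤-trans y<ℓ ℓ≤y))

  occ-∈ : ∀ x xs → x ∈ xs → 0 < occ x xs
  occ-∈ x (y ∷ ys) (here refl) with x ≡ᵇ x | eqView x x
  ... | true  | _            = z<s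
  ... | false | distinct x≢x = ⊥-elim (x≢x refl)
  occ-∈ x (y ∷ ys) (there x∈ys) with x ≡ᵇ y
  ... | true  = z<s
  ... | false = occ-∈ x ys x∈ys


  labelsArePerm⇒labelCount : ∀ t → LabelsArePerm t → LabelCount t
  labelsArePerm⇒labelCount t (inBounds , once) zero = occ-outside 0 (labels t) inBounds λ { (() , _) }
  labelsArePerm⇒labelCount t (inBounds , once) (suc y) with y <ᵇ internals t | ltView y (internals t)
  ... | true  | less y<ℓ    = All.lookup once (∈-map⁺ suc (∈-upTo⁺ y<ℓ))
  ... | false | notLess ℓ≤y = occ-outside (suc y) (labels t) inBounds λ (_ , y<ℓ) → <-irrefl refl (<-≤-trans y<ℓ ℓ≤y)

  labelCount⇒labelsArePerm : ∀ t → LabelCount t → LabelsArePerm t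
  labelCount⇒labelsArePerm t count = All.tabulate inBounds , All.tabulate once
    where
    inBounds : ∀ {x} → x ∈ labels t → 1 ≤ x × x ≤ internals t
    inBounds {x} x∈ = inRange-positive x (internals t) (subst (0 <_) (count x) (occ-∈ x (labels t) x∈))
    once : ∀ {x} → x ∈ map suc (upTo (internals t)) → occ x (labels t) ≡ 1
    once x∈ with ∈-map⁻ suc x∈
    ... | y , y∈ , refl = trans (count (suc y)) (inRange-inside y (internals t) (∈-upTo⁻ y∈))

  -- All the side conditions on trees are propositions, so an element of
  -- SIS n k is determined by its underlying tree.
  mutual
    schroeder-irrelevant : ∀ t → Irrelevant (IsSchroeder t)
    schroeder-irrelevant leaf        tt       tt         = refl
    schroeder-irrelevant (node _ cs) (l , s) (l′ , s′) = cong₂ _,_ (≤-irrelevant l l′) (schroederF-irrelevant cs s s′)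

    schroederF-irrelevant : ∀ cs → Irrelevant (IsSchroederL cs)
    schroederF-irrelevant []       tt      tt         = refl
    schroederF-irrelevant (c ∷ cs) (a , b) (a′ , b′) = cong₂ _,_ (schroeder-irrelevant c a a′) (schroederF-irrelevant cs b b′)

  mutual
    incAbove-irrelevant : ∀ b t → Irrelevant (IncAbove b t)
    incAbove-irrelevant b leaf        tt      tt         = refl
    incAbove-irrelevant b (node a cs) (l , s) (l′ , s′) = cong₂ _,_ (≤-irrelevant l l′) (incAboveF-irrelevant a cs s s′)

    incAboveF-irrelevant : ∀ b cs → Irrelevant (IncAboveL b cs)
    incAboveF-irrelevant b []       tt      tt         = refl
    incAboveF-irrelevant b (c ∷ cs) (x , y) (x′ , y′) = cong₂ _,_ (incAbove-irrelevant b c x x′) (incAboveF-irrelevant b cs y y′)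

  labelsArePerm-irrelevant : ∀ t → Irrelevant (LabelsArePerm t)
  labelsArePerm-irrelevant t (a , b) (a′ , b′) =
    cong₂ _,_ (All.irrelevant (λ (p , q) (p′ , q′) → cong₂ _,_ (≤-irrelevant p p′) (≤-irrelevant q q′)) a a′)
              (All.irrelevant ≡-irrelevant b b′)

  sis-irrelevant : ∀ t → Irrelevant (StronglyIncreasingSchroeder t)
  sis-irrelevant t (a , b , c) (a′ , b′ , c′) =
    cong₂ _,_ (schroeder-irrelevant t a a′) (cong₂ _,_ (incAbove-irrelevant 0 t b b′) (labelsArePerm-irrelevant t c c′))

  SIS-≡ : ∀ {n k} (a b : SIS n k) → proj₁ a ≡ proj₁ b → a ≡ b
  SIS-≡ (t , s , l , i) (.t , s′ , l′ , i′) refl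
    rewrite sis-irrelevant t s s′ | ≡-irrelevant l l′ | ≡-irrelevant i i′ = refl

  -- Grafting data for trees with N leaves and k + 1 internal nodes: a
  -- strongly increasing Schröder tree with k internal nodes, together with
  -- the arity c ≥ 2 and the leaf position of the node labelled k + 1.
  record Grafting (N k : ℕ) : Set where
    constructor grafting
    field
      tree       : Tree
      arity      : ℕ
      position   : ℕ
      isSIS      : StronglyIncreasingSchroeder tree
      internals≡ : internals tree ≡ k
      2≤arity    : 2 ≤ arity
      leaves≡    : leaves tree + arity ≡ suc N
      position<  : position < leaves tree

  open Grafting

  Grafting-≡ : ∀ {N k} (a b : Grafting N k) → tree a ≡ tree b → arity a ≡ arity b → position a ≡ position b → a ≡ b
  Grafting-≡ (grafting T c p s i a l q) (grafting .T .c .p s′ i′ a′ l′ q′) refl refl refl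
    rewrite sis-irrelevant T s s′ | ≡-irrelevant i i′ | ≤-irrelevant a a′ | ≡-irrelevant l l′ | ≤-irrelevant q q′ = refl

  labels≤top : ∀ t k → LabelsArePerm t → internals t ≡ k → All (_≤ k) (labels t)
  labels≤top t k (inBounds , _) i≡ = All.map (λ (_ , x≤ℓ) → subst (_ ≤_) i≡ x≤ℓ) inBounds

  occ-top : ∀ t k → LabelsArePerm t → internals t ≡ suc k → occT (suc k) t ≡ 1
  occ-top t k perm i≡ = begin
    occT (suc k) t                  ≡⟨ labelsArePerm⇒labelCount t perm (suc k) ⟩
    inRange (suc k) (internals t)   ≡⟨ cong (inRange (suc k)) i≡ ⟩
    inRange (suc k) (suc k)         ≡⟨ inRange-inside k (suc k) (n<1+n k) ⟩
    1                               ∎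
    where open ≡-Reasoning

  labels<top : ∀ t k → LabelsArePerm t → internals t ≡ k → All (_< suc k) (labels t)
  labels<top t k perm i = All.map s≤s (labels≤top t k perm i)

  module _ (N k : ℕ) where
    private
      L : ℕ
      L = suc k

    pruneTop : SIS N (suc k) → Grafting N k
    pruneTop (t , (s , inc , perm) , l≡ , i≡) = record
      { tree       = prune L t
      ; arity      = pruneArity L t
      ; position   = prunePos L t
      ; isSIS      = schroeder-prune L t s , incAbove-prune L 0 t inc , labelCount⇒labelsArePerm (prune L t) count
      ; internals≡ = i≡′
      ; 2≤arity    = 2≤pruneArity L t s occ>0
      ; leaves≡    = trans (leaves-prune L 0 t inc ≤L once) (cong suc l≡)
      ; position<  = prunePos<leaves L t occ>0
      }
      where
      ≤L    = labels≤top t L perm i≡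
      once  = occ-top t k perm i≡
      occ>0 = subst (0 <_) (sym once) z<s
      i≡′ : internals (prune L t) ≡ k
      i≡′ = suc-injective (trans (internals-prune L 0 t inc ≤L once) i≡)
      count : LabelCount (prune L t)
      count x = +-cancelˡ-≡ (δℕ x L) _ _ (begin
        δℕ x L + occT x (prune L t)               ≡⟨ occ-prune x L 0 t inc ≤L once ⟩
        occT x t                                  ≡⟨ labelsArePerm⇒labelCount t perm x ⟩
        inRange x (internals t)                   ≡⟨ cong (inRange x) i≡ ⟩
        inRange x (suc k)                         ≡⟨ inRange-suc x k ⟨
        δℕ x L + inRange x k                      ≡⟨ cong (λ m → δℕ x L + inRange x m) i≡′ ⟨
        δℕ x L + inRange x (internals (prune L t)) ∎)
        where open ≡-Reasoning

    graftTop : Grafting N k → SIS N (suc k)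
    graftTop (grafting T c p (s , inc , perm) i≡ 2≤c l≡ p<) =
      graft L c p T ,
      (schroeder-graft L c p T 2≤c s , incAbove-graft L c p 0 T z<s (labels<top T k perm i≡) inc ,
       labelCount⇒labelsArePerm (graft L c p T) count) ,
      suc-injective (trans (leaves-graft L c p T p<) l≡) , i≡′
      where
      i≡′ : internals (graft L c p T) ≡ suc k
      i≡′ = trans (internals-graft L c p T p<) (cong suc i≡)
      count : LabelCount (graft L c p T)
      count x = begin
        occT x (graft L c p T)                ≡⟨ occ-graft x L c p T p< ⟩
        δℕ x L + occT x T                     ≡⟨ cong (δℕ x L +_) (labelsArePerm⇒labelCount T perm x) ⟩
        δℕ x L + inRange x (internals T)      ≡⟨ cong (λ m → δℕ x L + inRange x m) i≡ ⟩
        δℕ x L + inRange x k                  ≡⟨ inRange-suc x k ⟩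
        inRange x (suc k)                     ≡⟨ cong (inRange x) i≡′ ⟨
        inRange x (internals (graft L c p T)) ∎
        where open ≡-Reasoning

    graftTop-pruneTop : ∀ a → graftTop (pruneTop a) ≡ a
    graftTop-pruneTop a@(t , (_ , inc , perm) , _ , i≡) =
      SIS-≡ (graftTop (pruneTop a)) a (graft-prune L 0 t inc (labels≤top t L perm i≡) (occ-top t k perm i≡))

    pruneTop-graftTop : ∀ b → pruneTop (graftTop b) ≡ b
    pruneTop-graftTop b@(grafting T c p (_ , _ , perm) i≡ _ _ p<) =
      Grafting-≡ (pruneTop (graftTop b)) b (prune-graft L c p T <L p<) (pruneArity-graft L c p T <L p<) (prunePos-graft L c p T <L p<)
      where <L = labels<top T k perm i≡

    SIS↔Grafting : SIS N (suc k) ↔ Grafting N k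
    SIS↔Grafting = mk↔ₛ′ pruneTop graftTop pruneTop-graftTop graftTop-pruneTop

  module _ (N k : ℕ) where
    private
      Binary : Set
      Binary = Fin N × SIS N k

    splitArity : Grafting (suc N) k → Grafting N k ⊎ Binary
    splitArity (grafting T 2 p s i≡ _ l≡ p<) = inj₂ (fromℕ< (subst (p <_) l≡′ p<) , (T , s , l≡′ , i≡))
      where
      l≡′ : leaves T ≡ N
      l≡′ = suc-injective (suc-injective (trans (+-comm 2 (leaves T)) l≡))
    splitArity (grafting T 0 p s i≡ () l≡ p<)
    splitArity (grafting T 1 p s i≡ (s≤s ()) l≡ p<)
    splitArity (grafting T (suc (suc (suc c))) p s i≡ _ l≡ p<) =
      inj₁ (grafting T (suc (suc c)) p s i≡ (s≤s (s≤s z≤n)) (suc-injective (trans (sym (+-suc (leaves T) _)) l≡)) p<)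

    joinArity : Grafting N k ⊎ Binary → Grafting (suc N) k
    joinArity (inj₁ (grafting T c p s i≡ 2≤c l≡ p<)) =
      grafting T (suc c) p s i≡ (m≤n⇒m≤1+n 2≤c) (trans (+-suc (leaves T) c) (cong suc l≡)) p<
    joinArity (inj₂ (q , (T , s , l≡ , i≡))) =
      grafting T 2 (toℕ q) s i≡ ≤-refl (trans (+-comm (leaves T) 2) (cong (2 +_) l≡)) (subst (toℕ q <_) (sym l≡) (toℕ<n q))

    joinArity-splitArity : ∀ a → joinArity (splitArity a) ≡ a
    joinArity-splitArity a@(grafting T 2 p _ _ _ _ _)                = Grafting-≡ _ a refl refl (toℕ-fromℕ< _)
    joinArity-splitArity a@(grafting T (suc (suc (suc c))) p _ _ _ _ _) = Grafting-≡ _ a refl refl refl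
    joinArity-splitArity (grafting T 0 p _ _ () _ _)
    joinArity-splitArity (grafting T 1 p _ _ (s≤s ()) _ _)

    splitArity-joinArity : ∀ b → splitArity (joinArity b) ≡ b
    splitArity-joinArity (inj₁ (grafting T (suc (suc c)) p _ _ _ _ _)) = cong inj₁ (Grafting-≡ _ _ refl refl refl)
    splitArity-joinArity (inj₁ (grafting T 0 p _ _ () _ _))
    splitArity-joinArity (inj₁ (grafting T 1 p _ _ (s≤s ()) _ _))
    splitArity-joinArity (inj₂ (q , T , _))                           = cong inj₂ (cong₂ _,_ (fromℕ<-toℕ q _) (SIS-≡ _ _ refl))

    Grafting-suc↔ : Grafting (suc N) k ↔ (Grafting N k ⊎ Binary)
    Grafting-suc↔ = mk↔ₛ′ splitArity joinArity splitArity-joinArity joinArity-splitArity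

  -- There is no grafting data for zero leaves (the arity alone exceeds 1).
  Grafting-zero : ∀ {k} → Grafting 0 k → ⊥
  Grafting-zero (grafting T c _ _ _ 2≤c l≡ _) = <-irrefl refl (begin-strict
    1               <⟨ 2≤c ⟩
    c               ≤⟨ m≤n+m c (leaves T) ⟩
    leaves T + c    ≡⟨ l≡ ⟩
    1               ∎)
    where open ≤-Reasoning

  module TreeCount (t : ℕ → ℕ → ℕ) (count : (n k : ℕ) → SIS n k ↔ Fin (t n k)) where

    Grafting↔Fin : ∀ N k → Grafting N k ↔ Fin (t N (suc k))
    Grafting↔Fin N k = ↔-trans (↔-sym (SIS↔Grafting N k)) (count N (suc k))

    t-recurrence : ∀ N k → t (suc N) (suc k) ≡ t N (suc k) + N * t N k
    t-recurrence N k = ↔⇒≡ (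
      ↔-trans (↔-sym (Grafting↔Fin (suc N) k))
     (↔-trans (Grafting-suc↔ N k)
     (↔-trans (Grafting↔Fin N k ⊎-↔ (↔-refl ×-↔ count N k))
     (↔-trans (↔-refl ⊎-↔ ↔-sym *↔×)
              (↔-sym +↔⊎)))))

    private
      empty⇒zero : ∀ {m} {A : Set} → A ↔ Fin m → (A → ⊥) → m ≡ 0
      empty⇒zero {zero}  _   _     = refl
      empty⇒zero {suc m} A↔ empty = ⊥-elim (empty (Inverse.from A↔ zero))

    t-zero-leaves : ∀ k → t 0 k ≡ 0
    t-zero-leaves zero    = empty⇒zero (count 0 0) λ { (leaf , _ , () , _) ; (node _ _ , _ , _ , ()) }
    t-zero-leaves (suc k) = empty⇒zero (Grafting↔Fin 0 k) Grafting-zero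

    t-no-internal : ∀ n → t (suc (suc n)) 0 ≡ 0
    t-no-internal n = empty⇒zero (count (suc (suc n)) 0) λ { (leaf , _ , () , _) ; (node _ _ , _ , _ , ()) }

    t-single-leaf : t 1 0 ≡ 1
    t-single-leaf = ↔⇒≡ (↔-trans (↔-sym (count 1 0)) (mk↔ₛ′ (λ _ → zero) (λ _ → single) (λ { zero → refl }) (λ a → sym (unique a))))
      where
      single : SIS 1 0
      single = leaf , (tt , tt , [] , []) , refl , refl
      unique : ∀ a → a ≡ single
      unique a@(leaf , _)           = SIS-≡ a single refl
      unique (node _ _ , _ , _ , ())

module FiniteSums where

  open import Data.Nat as ℕ using (ℕ; zero; suc; _<_; s≤s; z<s; _!; _≡ᵇ_)
  import Data.Nat.Properties as ℕₚ
  open import Data.Integer as ℤ using (ℤ)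
  open import Data.Rational using (ℚ; 0ℚ; 1ℚ; _+_; _*_; -_; _/_; toℚᵘ)
  import Data.Rational.Properties as ℚₚ
  import Data.Rational.Unnormalised as ℚᵘ
  import Data.Rational.Unnormalised.Properties as ℚᵘₚ
  import Data.Integer.Properties as ℤₚ
  import Data.Integer.Solver as ℤ-Solver
  open import Data.Rational.Solver using () renaming (module +-*-Solver to ℚ-Solver)
  open import Data.Bool using (true; false; T)
  open import Data.List using (map; applyUpTo)
  open import Data.Unit using (tt)
  open import Data.Empty using (⊥-elim)
  open import Relation.Binary.PropositionalEquality
  open import Relation.Nullary using (¬_; yes; no)

  -- The cast ℕ → ℚ, by repeated addition of 1, so that it visibly
  -- preserves sums and products.
  ι : ℕ → ℚ
  ι zero    = 0ℚ
  ι (suc n) = 1ℚ + ι n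

  ι-+ : ∀ m n → ι (m ℕ.+ n) ≡ ι m + ι n
  ι-+ zero    n = sym (ℚₚ.+-identityˡ (ι n))
  ι-+ (suc m) n = trans (cong (1ℚ +_) (ι-+ m n)) (sym (ℚₚ.+-assoc 1ℚ (ι m) (ι n)))

  ι-* : ∀ m n → ι (m ℕ.* n) ≡ ι m * ι n
  ι-* zero    n = sym (ℚₚ.*-zeroˡ (ι n))
  ι-* (suc m) n = begin
    ι (n ℕ.+ m ℕ.* n)   ≡⟨ trans (ι-+ n (m ℕ.* n)) (cong (ι n +_) (ι-* m n)) ⟩
    ι n + ι m * ι n     ≡⟨ cong (_+ ι m * ι n) (ℚₚ.*-identityˡ (ι n)) ⟨
    1ℚ * ι n + ι m * ι n ≡⟨ ℚₚ.*-distribʳ-+ (ι n) 1ℚ (ι m) ⟨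
    (1ℚ + ι m) * ι n    ∎
    where open ≡-Reasoning

  ι-1 : ι 1 ≡ 1ℚ
  ι-1 = ℚₚ.+-identityʳ 1ℚ

  ι≡/1 : ∀ n → ι n ≡ (ℤ.+ n) / 1
  ι≡/1 zero    = refl
  ι≡/1 (suc n) = ℚₚ.toℚᵘ-injective (begin
    toℚᵘ (1ℚ + ι n)                           ≈⟨ ℚₚ.toℚᵘ-homo-+ 1ℚ (ι n) ⟩
    toℚᵘ 1ℚ ℚᵘ.+ toℚᵘ (ι n)                   ≈⟨ ℚᵘₚ.+-congʳ (toℚᵘ 1ℚ) (ℚᵘₚ.≃-trans (ℚₚ.toℚᵘ-cong (ι≡/1 n)) (ℚₚ.toℚᵘ-fromℚᵘ (ℚᵘ.mkℚᵘ (ℤ.+ n) 0))) ⟩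
    ℚᵘ.mkℚᵘ (ℤ.+ 1) 0 ℚᵘ.+ ℚᵘ.mkℚᵘ (ℤ.+ n) 0 ≈⟨ ℚᵘ.*≡* (sum-over-1 (ℤ.+ n)) ⟩
    ℚᵘ.mkℚᵘ (ℤ.+ suc n) 0                     ≈⟨ ℚₚ.toℚᵘ-fromℚᵘ (ℚᵘ.mkℚᵘ (ℤ.+ suc n) 0) ⟨
    toℚᵘ ((ℤ.+ suc n) / 1)                    ∎)
    where
    open ℚᵘₚ.≃-Reasoning
    sum-over-1 : ∀ x → (ℤ.+ 1 ℤ.* ℤ.+ 1 ℤ.+ x ℤ.* ℤ.+ 1) ℤ.* ℤ.+ 1 ≡ (ℤ.+ 1 ℤ.+ x) ℤ.* (ℤ.+ 1 ℤ.* ℤ.+ 1)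
    sum-over-1 = solve 1 (λ x → (con (ℤ.+ 1) :* con (ℤ.+ 1) :+ x :* con (ℤ.+ 1)) :* con (ℤ.+ 1)
                             := (con (ℤ.+ 1) :+ x) :* (con (ℤ.+ 1) :* con (ℤ.+ 1))) refl
      where open ℤ-Solver.+-*-Solver

  /-*-cancel : ∀ a d .{{_ : ℕ.NonZero d}} → ((ℤ.+ a) / d) * ι d ≡ ι a
  /-*-cancel a d@(suc d-1) rewrite ι≡/1 d | ι≡/1 a = ℚₚ.toℚᵘ-injective (begin
    toℚᵘ (((ℤ.+ a) / d) * ((ℤ.+ d) / 1))                 ≈⟨ ℚₚ.toℚᵘ-homo-* ((ℤ.+ a) / d) ((ℤ.+ d) / 1) ⟩
    toℚᵘ ((ℤ.+ a) / d) ℚᵘ.* toℚᵘ ((ℤ.+ d) / 1)           ≈⟨ ℚᵘₚ.*-cong (ℚₚ.toℚᵘ-fromℚᵘ (ℚᵘ.mkℚᵘ (ℤ.+ a) d-1)) (ℚₚ.toℚᵘ-fromℚᵘ (ℚᵘ.mkℚᵘ (ℤ.+ d) 0)) ⟩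
    ℚᵘ.mkℚᵘ (ℤ.+ a) d-1 ℚᵘ.* ℚᵘ.mkℚᵘ (ℤ.+ d) 0           ≈⟨ ℚᵘ.*≡* (cross (ℤ.+ a) d) ⟩
    ℚᵘ.mkℚᵘ (ℤ.+ a) 0                                    ≈⟨ ℚₚ.toℚᵘ-fromℚᵘ (ℚᵘ.mkℚᵘ (ℤ.+ a) 0) ⟨
    toℚᵘ ((ℤ.+ a) / 1)                                   ∎)
    where
    open ℚᵘₚ.≃-Reasoning
    cross : ∀ x m → (x ℤ.* ℤ.+ m) ℤ.* ℤ.+ 1 ≡ x ℤ.* ℤ.+ (m ℕ.* 1)
    cross x m rewrite ℕₚ.*-identityʳ m = ℤₚ.*-identityʳ (x ℤ.* ℤ.+ m)

  Σ< : ℕ → (ℕ → ℚ) → ℚ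
  Σ< zero    f = 0ℚ
  Σ< (suc n) f = f 0 + Σ< n (λ i → f (suc i))

  Σ≤≡Σ< : ∀ n f → Σ≤ n f ≡ Σ< (suc n) f
  Σ≤≡Σ< n f = go f (λ i → i) (suc n)
    where
    go : ∀ (f : ℕ → ℚ) g n → sumℚ (map f (applyUpTo g n)) ≡ Σ< n (λ i → f (g i))
    go f g zero    = refl
    go f g (suc n) = cong (f (g 0) +_) (go f (λ i → g (suc i)) n)

  Σ<-last : ∀ n f → Σ< (suc n) f ≡ Σ< n f + f n
  Σ<-last zero    f = trans (ℚₚ.+-identityʳ (f 0)) (sym (ℚₚ.+-identityˡ (f 0)))
  Σ<-last (suc n) f = trans (cong (f 0 +_) (Σ<-last n (λ i → f (suc i)))) (sym (ℚₚ.+-assoc (f 0) _ _))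

  Σ<-cong : ∀ n {f g} → (∀ i → i < n → f i ≡ g i) → Σ< n f ≡ Σ< n g
  Σ<-cong zero    f≡g = refl
  Σ<-cong (suc n) f≡g = cong₂ _+_ (f≡g 0 z<s) (Σ<-cong n (λ i i<n → f≡g (suc i) (s≤s i<n)))

  Σ<-+ : ∀ n f g → Σ< n (λ i → f i + g i) ≡ Σ< n f + Σ< n g
  Σ<-+ zero    f g = sym (ℚₚ.+-identityʳ 0ℚ)
  Σ<-+ (suc n) f g rewrite Σ<-+ n (λ i → f (suc i)) (λ i → g (suc i)) =
    solve 4 (λ a b c d → (a :+ b) :+ (c :+ d) := (a :+ c) :+ (b :+ d)) refl
      (f 0) (g 0) (Σ< n (λ i → f (suc i))) (Σ< n (λ i → g (suc i)))
    where open ℚ-Solver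

  Σ<-* : ∀ n c f → Σ< n (λ i → c * f i) ≡ c * Σ< n f
  Σ<-* zero    c f = sym (ℚₚ.*-zeroʳ c)
  Σ<-* (suc n) c f rewrite Σ<-* n c (λ i → f (suc i)) = sym (ℚₚ.*-distribˡ-+ c (f 0) _)

  Σ<-neg : ∀ n f → Σ< n (λ i → - f i) ≡ - Σ< n f
  Σ<-neg zero    f = refl
  Σ<-neg (suc n) f rewrite Σ<-neg n (λ i → f (suc i)) = sym (ℚₚ.neg-distrib-+ (f 0) _)

  Σ<-zero : ∀ n {f} → (∀ i → i < n → f i ≡ 0ℚ) → Σ< n f ≡ 0ℚ
  Σ<-zero zero    f≡0 = refl
  Σ<-zero (suc n) f≡0 rewrite f≡0 0 z<s | Σ<-zero n (λ i i<n → f≡0 (suc i) (s≤s i<n)) = refl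

  Σ<-single : ∀ n m {f} → m < n → (∀ i → i < n → ¬ i ≡ m → f i ≡ 0ℚ) → Σ< n f ≡ f m
  Σ<-single (suc n) m {f} m<1+n others with m ℕ.≟ n
  ... | yes refl = begin
    Σ< (suc n) f ≡⟨ Σ<-last n f ⟩
    Σ< n f + f n ≡⟨ cong (_+ f n) (Σ<-zero n (λ i i<n → others i (ℕₚ.m<n⇒m<1+n i<n) (λ { refl → ℕₚ.<-irrefl refl i<n }))) ⟩
    0ℚ + f n     ≡⟨ ℚₚ.+-identityˡ (f n) ⟩
    f n          ∎
    where open ≡-Reasoning
  ... | no m≢n = begin
    Σ< (suc n) f ≡⟨ Σ<-last n f ⟩
    Σ< n f + f n ≡⟨ cong₂ _+_ (Σ<-single n m (ℕₚ.≤∧≢⇒< (ℕₚ.≤-pred m<1+n) m≢n) (λ i i<n → others i (ℕₚ.m<n⇒m<1+n i<n)))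
                              (others n ℕₚ.≤-refl (λ n≡m → m≢n (sym n≡m))) ⟩
    f m + 0ℚ     ≡⟨ ℚₚ.+-identityʳ (f m) ⟩
    f m          ∎
    where open ≡-Reasoning

  δ-refl : ∀ a → δ a a ≡ 1ℚ
  δ-refl a with a ≡ᵇ a in e
  ... | true  = refl
  ... | false = ⊥-elim (subst T e (ℕₚ.≡⇒≡ᵇ a a refl))

  δ-distinct : ∀ a b → ¬ a ≡ b → δ a b ≡ 0ℚ
  δ-distinct a b a≢b with a ≡ᵇ b in e
  ... | true  = ⊥-elim (a≢b (ℕₚ.≡ᵇ⇒≡ a b (subst T (sym e) tt)))
  ... | false = refl

  δ-cong : ∀ a b a′ b′ → (a ≡ b → a′ ≡ b′) → (a′ ≡ b′ → a ≡ b) → δ a b ≡ δ a′ b′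
  δ-cong a b a′ b′ to from with a ℕ.≟ b | a′ ℕ.≟ b′
  ... | yes refl | yes refl = trans (δ-refl a) (sym (δ-refl a′))
  ... | yes a≡b  | no a′≢b′ = ⊥-elim (a′≢b′ (to a≡b))
  ... | no a≢b   | yes a′≡b′ = ⊥-elim (a≢b (from a′≡b′))
  ... | no a≢b   | no a′≢b′ = trans (δ-distinct a b a≢b) (sym (δ-distinct a′ b′ a′≢b′))

  δ-distinct-* : ∀ a b x → ¬ a ≡ b → δ a b * x ≡ 0ℚ
  δ-distinct-* a b x a≢b = trans (cong (_* x) (δ-distinct a b a≢b)) (ℚₚ.*-zeroˡ x)

  *ι-cancel : ∀ x y d .{{_ : ℕ.NonZero d}} → x * ι d ≡ y * ι d → x ≡ y
  *ι-cancel x y d eq = begin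
    x                  ≡⟨ ℚₚ.*-identityʳ x ⟨
    x * 1ℚ             ≡⟨ cong (x *_) ι-inverse ⟨
    x * (ι d * d⁻¹)    ≡⟨ ℚₚ.*-assoc x (ι d) d⁻¹ ⟨
    (x * ι d) * d⁻¹    ≡⟨ cong (_* d⁻¹) eq ⟩
    (y * ι d) * d⁻¹    ≡⟨ ℚₚ.*-assoc y (ι d) d⁻¹ ⟩
    y * (ι d * d⁻¹)    ≡⟨ cong (y *_) ι-inverse ⟩
    y * 1ℚ             ≡⟨ ℚₚ.*-identityʳ y ⟩
    y                  ∎
    where
    open ≡-Reasoning
    d⁻¹ = (ℤ.+ 1) / d
    ι-inverse : ι d * d⁻¹ ≡ 1ℚ
    ι-inverse = trans (ℚₚ.*-comm (ι d) d⁻¹) (trans (/-*-cancel 1 d) ι-1)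

  invFact-inverse : ∀ j → invFact j * ι (j !) ≡ 1ℚ
  invFact-inverse j = trans (/-*-cancel 1 (j !) {{j ℕₚ.!≢0}}) ι-1

module LogarithmPowers where

  open FiniteSums
  open import Data.Nat as ℕ using (ℕ; zero; suc; _∸_; _<_; z<s; _!)
  import Data.Nat.Properties as ℕₚ
  open import Data.Integer as ℤ using ()
  open import Data.Rational using (ℚ; 0ℚ; 1ℚ; _+_; _*_; -_; _/_)
  import Data.Rational.Properties as ℚₚ
  open import Data.Rational.Solver using () renaming (module +-*-Solver to ℚ-Solver)
  open import Relation.Binary.PropositionalEquality

  -- One-variable power series are coefficient functions ℕ → ℚ.
  -- Cauchy product, derivative, and multiplication by 1 - z.
  conv : (ℕ → ℚ) → (ℕ → ℚ) → ℕ → ℚ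
  conv f g n = Σ< (suc n) (λ i → f i * g (n ∸ i))

  deriv : (ℕ → ℚ) → ℕ → ℚ
  deriv f n = ι (suc n) * f (suc n)

  Δ : (ℕ → ℚ) → ℕ → ℚ
  Δ f zero    = f 0
  Δ f (suc n) = f (suc n) + - f n

  -- lg = log (1 / (1 - z)) = Σ_{m ≥ 1} z^m / m, and lgPow j = lg^j.
  lg : ℕ → ℚ
  lg zero    = 0ℚ
  lg (suc m) = (ℤ.+ 1) / suc m

  lgPow : ℕ → ℕ → ℚ
  lgPow zero    n = δ n 0
  lgPow (suc j) n = conv lg (lgPow j) n

  conv-congʳ : ∀ f {g h} n → (∀ i → g i ≡ h i) → conv f g n ≡ conv f h n
  conv-congʳ f n g≡h = Σ<-cong (suc n) (λ i _ → cong (f i *_) (g≡h (n ∸ i)))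

  conv-congˡ : ∀ {f f′} g n → (∀ i → f i ≡ f′ i) → conv f g n ≡ conv f′ g n
  conv-congˡ g n f≡f′ = Σ<-cong (suc n) (λ i _ → cong (_* g (n ∸ i)) (f≡f′ i))

  conv-scalar : ∀ f g a n → conv f (λ i → a * g i) n ≡ a * conv f g n
  conv-scalar f g a n =
    trans (Σ<-cong (suc n) (λ i _ → solve 3 (λ x y z → x :* (y :* z) := y :* (x :* z)) refl (f i) a (g (n ∸ i))))
          (Σ<-* (suc n) a (λ i → f i * g (n ∸ i)))
    where open ℚ-Solver

  conv-zero : ∀ f n → conv f (λ _ → 0ℚ) n ≡ 0ℚ
  conv-zero f n = Σ<-zero (suc n) (λ i _ → ℚₚ.*-zeroʳ (f i))

  deriv-conv : ∀ f g n → deriv (conv f g) n ≡ conv (deriv f) g n + conv f (deriv g) n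
  deriv-conv f g n = begin
    ι (suc n) * Σ< (suc (suc n)) h                                 ≡⟨ Σ<-* (suc (suc n)) (ι (suc n)) h ⟨
    Σ< (suc (suc n)) (λ i → ι (suc n) * h i)                       ≡⟨ Σ<-cong (suc (suc n)) split ⟩
    Σ< (suc (suc n)) (λ i → ι i * h i + ι (suc n ∸ i) * h i)       ≡⟨ Σ<-+ (suc (suc n)) (λ i → ι i * h i) (λ i → ι (suc n ∸ i) * h i) ⟩
    Σ< (suc (suc n)) (λ i → ι i * h i) + Σ< (suc (suc n)) (λ i → ι (suc n ∸ i) * h i)
                                                                   ≡⟨ cong₂ _+_ left right ⟩
    conv (deriv f) g n + conv f (deriv g) n                        ∎
    where
    open ≡-Reasoning
    open ℚ-Solver using (solve; _:*_; _:=_)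
    h : ℕ → ℚ
    h i = f i * g (suc n ∸ i)
    -- n + 1 = i + (n + 1 - i) distributes the factor of the derivative
    split : ∀ i → i < suc (suc n) → ι (suc n) * h i ≡ ι i * h i + ι (suc n ∸ i) * h i
    split i i<n+2 = trans (cong (λ m → ι m * h i) (sym (ℕₚ.m+[n∸m]≡n (ℕₚ.≤-pred i<n+2))))
                          (trans (cong (_* h i) (ι-+ i (suc n ∸ i))) (ℚₚ.*-distribʳ-+ (h i) (ι i) _))
    -- the i = 0 term of the first sum vanishes
    left : Σ< (suc (suc n)) (λ i → ι i * h i) ≡ conv (deriv f) g n
    left = trans (cong (_+ Σ< (suc n) (λ i → ι (suc i) * h (suc i))) (ℚₚ.*-zeroˡ (h 0)))
                 (trans (ℚₚ.+-identityˡ _) (Σ<-cong (suc n) (λ i _ → sym (ℚₚ.*-assoc (ι (suc i)) (f (suc i)) (g (n ∸ i))))))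
    -- the i = n + 1 term of the second sum vanishes
    right : Σ< (suc (suc n)) (λ i → ι (suc n ∸ i) * h i) ≡ conv f (deriv g) n
    right = begin
      Σ< (suc (suc n)) (λ i → ι (suc n ∸ i) * h i)                   ≡⟨ Σ<-last (suc n) (λ i → ι (suc n ∸ i) * h i) ⟩
      Σ< (suc n) (λ i → ι (suc n ∸ i) * h i) + ι (suc n ∸ suc n) * h (suc n)
                                                                     ≡⟨ cong (Σ< (suc n) (λ i → ι (suc n ∸ i) * h i) +_)
                                                                             (trans (cong (λ m → ι m * h (suc n)) (ℕₚ.n∸n≡0 n)) (ℚₚ.*-zeroˡ (h (suc n)))) ⟩
      Σ< (suc n) (λ i → ι (suc n ∸ i) * h i) + 0ℚ                    ≡⟨ ℚₚ.+-identityʳ _ ⟩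
      Σ< (suc n) (λ i → ι (suc n ∸ i) * h i)                         ≡⟨ Σ<-cong (suc n) reorder ⟩
      conv f (deriv g) n                                             ∎
      where
      reorder : ∀ i → i < suc n → ι (suc n ∸ i) * h i ≡ f i * deriv g (n ∸ i)
      reorder i i<n+1 rewrite ℕₚ.+-∸-assoc 1 (ℕₚ.≤-pred i<n+1) =
        solve 3 (λ a b d → a :* (b :* d) := b :* (a :* d)) refl (ι (suc (n ∸ i))) (f i) (g (suc (n ∸ i)))

  Δ-cong : ∀ {f g} n → (∀ i → f i ≡ g i) → Δ f n ≡ Δ g n
  Δ-cong zero    f≡g = f≡g 0
  Δ-cong (suc n) f≡g = cong₂ (λ a b → a + - b) (f≡g (suc n)) (f≡g n)

  Δ-zero : ∀ {f} n → (∀ i → f i ≡ 0ℚ) → Δ f n ≡ 0ℚ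
  Δ-zero zero    f≡0 = f≡0 0
  Δ-zero (suc n) f≡0 rewrite f≡0 (suc n) | f≡0 n = refl

  Δ-+ : ∀ f g n → Δ (λ i → f i + g i) n ≡ Δ f n + Δ g n
  Δ-+ f g zero    = refl
  Δ-+ f g (suc n) =
    solve 4 (λ a b x y → (a :+ b) :- (x :+ y) := (a :- x) :+ (b :- y)) refl (f (suc n)) (g (suc n)) (f n) (g n)
    where open ℚ-Solver

  Δ-conv : ∀ f g n → Δ (conv f g) n ≡ conv f (Δ g) n
  Δ-conv f g zero    = refl
  Δ-conv f g (suc n) = begin
    Σ< (suc (suc n)) H + - Σ< (suc n) G                      ≡⟨ cong (_+ - Σ< (suc n) G) (Σ<-last (suc n) H) ⟩
    (Σ< (suc n) H + H (suc n)) + - Σ< (suc n) G              ≡⟨ solve 3 (λ a b x → (a :+ b) :- x := (a :- x) :+ b) refl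
                                                                       (Σ< (suc n) H) (H (suc n)) (Σ< (suc n) G) ⟩
    (Σ< (suc n) H + - Σ< (suc n) G) + H (suc n)              ≡⟨ cong (λ z → (Σ< (suc n) H + z) + H (suc n)) (Σ<-neg (suc n) G) ⟨
    (Σ< (suc n) H + Σ< (suc n) (λ i → - G i)) + H (suc n)    ≡⟨ cong (_+ H (suc n)) (Σ<-+ (suc n) H (λ i → - G i)) ⟨
    Σ< (suc n) (λ i → H i + - G i) + H (suc n)               ≡⟨ cong₂ _+_ (Σ<-cong (suc n) termwise) last ⟩
    Σ< (suc n) K + K (suc n)                                 ≡⟨ Σ<-last (suc n) K ⟨
    conv f (Δ g) (suc n)                                     ∎
    where
    open ≡-Reasoning
    open ℚ-Solver
    H G K : ℕ → ℚ
    H i = f i * g (suc n ∸ i)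
    G i = f i * g (n ∸ i)
    K i = f i * Δ g (suc n ∸ i)
    last : H (suc n) ≡ K (suc n)
    last rewrite ℕₚ.n∸n≡0 n = refl
    termwise : ∀ i → i < suc n → H i + - G i ≡ K i
    termwise i i<n+1 rewrite ℕₚ.+-∸-assoc 1 (ℕₚ.≤-pred i<n+1) =
      solve 3 (λ a x y → a :* x :- a :* y := a :* (x :- y)) refl (f i) (g (suc (n ∸ i))) (g (n ∸ i))

  Δ-conv-one : ∀ g n → Δ (conv (λ _ → 1ℚ) g) n ≡ g n
  Δ-conv-one g zero    = trans (ℚₚ.+-identityʳ _) (ℚₚ.*-identityˡ (g 0))
  Δ-conv-one g (suc n) =
    trans (solve 2 (λ a x → (a :+ x) :- x := a) refl (1ℚ * g (suc n)) (Σ< (suc n) (λ i → 1ℚ * g (n ∸ i))))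
          (ℚₚ.*-identityˡ (g (suc n)))
    where open ℚ-Solver

  deriv-lg : ∀ n → deriv lg n ≡ 1ℚ
  deriv-lg n = trans (ℚₚ.*-comm (ι (suc n)) (lg (suc n))) (trans (/-*-cancel 1 (suc n)) ι-1)

  -- (1 - z) (lg^(j+1))′ = (j + 1) lg^j: by the Leibniz rule,
  -- (lg · lg^j)′ = lg^j / (1 - z) + lg · (lg^j)′, and induction on j.
  Δ-deriv-lgPow-step : ∀ j n → Δ (deriv (lgPow (suc j))) n ≡ lgPow j n + conv lg (Δ (deriv (lgPow j))) n
  Δ-deriv-lgPow-step j n = begin
    Δ (deriv (lgPow (suc j))) n                                      ≡⟨ Δ-cong n leibniz ⟩
    Δ (λ i → conv (λ _ → 1ℚ) (lgPow j) i + conv lg (deriv (lgPow j)) i) n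
                                                                     ≡⟨ Δ-+ (conv (λ _ → 1ℚ) (lgPow j)) (conv lg (deriv (lgPow j))) n ⟩
    Δ (conv (λ _ → 1ℚ) (lgPow j)) n + Δ (conv lg (deriv (lgPow j))) n ≡⟨ cong₂ _+_ (Δ-conv-one (lgPow j) n) (Δ-conv lg (deriv (lgPow j)) n) ⟩
    lgPow j n + conv lg (Δ (deriv (lgPow j))) n                      ∎
    where
    open ≡-Reasoning
    leibniz : ∀ i → deriv (lgPow (suc j)) i ≡ conv (λ _ → 1ℚ) (lgPow j) i + conv lg (deriv (lgPow j)) i
    leibniz i = trans (deriv-conv lg (lgPow j) i) (cong (_+ conv lg (deriv (lgPow j)) i) (conv-congˡ (lgPow j) i deriv-lg))

  Δ-deriv-lgPow : ∀ j n → Δ (deriv (lgPow (suc j))) n ≡ ι (suc j) * lgPow j n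
  Δ-deriv-lgPow zero n = begin
    Δ (deriv (lgPow 1)) n                         ≡⟨ Δ-deriv-lgPow-step 0 n ⟩
    lgPow 0 n + conv lg (Δ (deriv (lgPow 0))) n   ≡⟨ cong (lgPow 0 n +_) (trans (conv-congʳ lg n constant) (conv-zero lg n)) ⟩
    lgPow 0 n + 0ℚ                                ≡⟨ solve 1 (λ x → x :+ con 0ℚ := (con 1ℚ :+ con 0ℚ) :* x) refl (lgPow 0 n) ⟩
    ι 1 * lgPow 0 n                               ∎
    where
    open ≡-Reasoning
    open ℚ-Solver
    constant : ∀ i → Δ (deriv (lgPow 0)) i ≡ 0ℚ
    constant i = Δ-zero i (λ i′ → ℚₚ.*-zeroʳ (ι (suc i′)))
  Δ-deriv-lgPow (suc j) n = begin
    Δ (deriv (lgPow (suc (suc j)))) n                         ≡⟨ Δ-deriv-lgPow-step (suc j) n ⟩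
    lgPow (suc j) n + conv lg (Δ (deriv (lgPow (suc j)))) n   ≡⟨ cong (lgPow (suc j) n +_) (trans (conv-congʳ lg n (Δ-deriv-lgPow j))
                                                                                             (conv-scalar lg (lgPow j) (ι (suc j)) n)) ⟩
    lgPow (suc j) n + ι (suc j) * lgPow (suc j) n             ≡⟨ solve 2 (λ x a → x :+ a :* x := (con 1ℚ :+ a) :* x) refl (lgPow (suc j) n) (ι (suc j)) ⟩
    ι (suc (suc j)) * lgPow (suc j) n                         ∎
    where
    open ≡-Reasoning
    open ℚ-Solver

  lgPow-recurrence : ∀ j n → ι (suc n) * lgPow (suc j) (suc n) ≡ ι n * lgPow (suc j) n + ι (suc j) * lgPow j n
  lgPow-recurrence j zero = trans (Δ-deriv-lgPow j 0)
    (sym (trans (cong (_+ ι (suc j) * lgPow j 0) (ℚₚ.*-zeroˡ (lgPow (suc j) 0))) (ℚₚ.+-identityˡ _)))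
  lgPow-recurrence j (suc m) = begin
    A                              ≡⟨ solve 2 (λ a b → a := (a :- b) :+ b) refl A B ⟩
    (A + - B) + B                  ≡⟨ cong (_+ B) (Δ-deriv-lgPow j (suc m)) ⟩
    ι (suc j) * lgPow j (suc m) + B ≡⟨ ℚₚ.+-comm (ι (suc j) * lgPow j (suc m)) B ⟩
    B + ι (suc j) * lgPow j (suc m) ∎
    where
    open ≡-Reasoning
    open ℚ-Solver
    A = ι (suc (suc m)) * lgPow (suc j) (suc (suc m))
    B = ι (suc m) * lgPow (suc j) (suc m)

  lgPow-low : ∀ j n → n < j → lgPow j n ≡ 0ℚ
  lgPow-low (suc j) n n<j+1 = Σ<-zero (suc n) term
    where
    term : ∀ i → i < suc n → lg i * lgPow j (n ∸ i) ≡ 0ℚ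
    term zero    _       = ℚₚ.*-zeroˡ (lgPow j n)
    term (suc i) i<n+1 = trans (cong (lg (suc i) *_) (lgPow-low j (n ∸ suc i) n-i-1<j)) (ℚₚ.*-zeroʳ (lg (suc i)))
      where
      n-i-1<j : n ∸ suc i < j
      n-i-1<j = ℕₚ.<-≤-trans (ℕₚ.∸-monoʳ-< z<s (ℕₚ.≤-pred i<n+1)) (ℕₚ.≤-pred n<j+1)

  stirling : ℕ → ℕ → ℕ
  stirling zero    zero    = 1
  stirling zero    (suc j) = 0
  stirling (suc n) zero    = 0
  stirling (suc n) (suc j) = n ℕ.* stirling n (suc j) ℕ.+ stirling n j

  lgPow-stirling : ∀ n j → lgPow j n * ι (n !) ≡ ι (j !) * ι (stirling n j)
  lgPow-stirling zero    zero    = refl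
  lgPow-stirling zero    (suc j) = trans (cong (_* ι 1) (lgPow-low (suc j) 0 z<s))
                                         (trans (ℚₚ.*-zeroˡ (ι 1)) (sym (ℚₚ.*-zeroʳ (ι (suc j !)))))
  lgPow-stirling (suc n) zero    = trans (ℚₚ.*-zeroˡ (ι (suc n !))) (sym (ℚₚ.*-zeroʳ (ι 1)))
  lgPow-stirling (suc n) (suc j) = begin
    c₁ * ι (suc n ℕ.* n !)                              ≡⟨ cong (c₁ *_) (ι-* (suc n) (n !)) ⟩
    c₁ * (ι (suc n) * ι (n !))                          ≡⟨ solve 3 (λ x a b → x :* (a :* b) := (a :* x) :* b) refl c₁ (ι (suc n)) (ι (n !)) ⟩
    (ι (suc n) * c₁) * ι (n !)                          ≡⟨ cong (_* ι (n !)) (lgPow-recurrence j n) ⟩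
    (ι n * c₂ + ι (suc j) * c₃) * ι (n !)               ≡⟨ solve 5 (λ a x b y f → (a :* x :+ b :* y) :* f := a :* (x :* f) :+ b :* (y :* f)) refl
                                                                 (ι n) c₂ (ι (suc j)) c₃ (ι (n !)) ⟩
    ι n * (c₂ * ι (n !)) + ι (suc j) * (c₃ * ι (n !))   ≡⟨ cong₂ (λ u v → ι n * u + ι (suc j) * v) (lgPow-stirling n (suc j)) (lgPow-stirling n j) ⟩
    ι n * (ι (suc j ℕ.* j !) * s₁) + ι (suc j) * (ι (j !) * s₂)
                                                        ≡⟨ cong (λ u → ι n * (u * s₁) + ι (suc j) * (ι (j !) * s₂)) (ι-* (suc j) (j !)) ⟩
    ι n * ((ι (suc j) * ι (j !)) * s₁) + ι (suc j) * (ι (j !) * s₂)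
                                                        ≡⟨ solve 5 (λ a s f u v → a :* ((s :* f) :* u) :+ s :* (f :* v) := (s :* f) :* (a :* u :+ v)) refl
                                                                 (ι n) (ι (suc j)) (ι (j !)) s₁ s₂ ⟩
    (ι (suc j) * ι (j !)) * (ι n * s₁ + s₂)             ≡⟨ cong₂ _*_ (ι-* (suc j) (j !)) (trans (ι-+ (n ℕ.* stirling n (suc j)) _) (cong (_+ s₂) (ι-* n _))) ⟨
    ι (suc j ℕ.* j !) * ι (n ℕ.* stirling n (suc j) ℕ.+ stirling n j) ∎
    where
    open ≡-Reasoning
    open ℚ-Solver
    c₁ = lgPow (suc j) (suc n)
    c₂ = lgPow (suc j) n
    c₃ = lgPow j n
    s₁ = ι (stirling n (suc j))
    s₂ = ι (stirling n j)

module BivariateSeries where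

  open FiniteSums
  open LogarithmPowers
  open import Data.Nat as ℕ using (ℕ; zero; suc; _∸_; _≤_; _<_; z≤n; s≤s; z<s; _!)
  import Data.Nat.Properties as ℕₚ
  open import Data.Rational using (ℚ; 0ℚ; 1ℚ; _+_; _*_; -_)
  import Data.Rational.Properties as ℚₚ
  open import Data.Rational.Solver using () renaming (module +-*-Solver to ℚ-Solver)
  open import Relation.Binary.PropositionalEquality
  open import Relation.Nullary using (¬_; yes; no)

  timesU : Series → Series
  timesU F n zero    = 0ℚ
  timesU F n (suc k) = F n k

  ⊗-z-free : ∀ (X : Series) (x : ℕ → ℚ) F n k → (∀ i j → X i j ≡ δ i 0 * x j) →
             (X ⊗ F) n k ≡ Σ< (suc k) (λ j → x j * F n (k ∸ j))
  ⊗-z-free X x F n k X≡ = begin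
    Σ≤ n (λ i → Σ≤ k (λ j → X i j * F (n ∸ i) (k ∸ j)))       ≡⟨ Σ≤≡Σ< n (λ i → Σ≤ k (λ j → X i j * F (n ∸ i) (k ∸ j))) ⟩
    Σ< (suc n) (λ i → Σ≤ k (λ j → X i j * F (n ∸ i) (k ∸ j))) ≡⟨ Σ<-single (suc n) 0 z<s positive-i ⟩
    Σ≤ k (λ j → X 0 j * F n (k ∸ j))                          ≡⟨ Σ≤≡Σ< k (λ j → X 0 j * F n (k ∸ j)) ⟩
    Σ< (suc k) (λ j → X 0 j * F n (k ∸ j))                    ≡⟨ Σ<-cong (suc k) (λ j _ → cong (_* F n (k ∸ j)) (trans (X≡ 0 j) (ℚₚ.*-identityˡ (x j)))) ⟩
    Σ< (suc k) (λ j → x j * F n (k ∸ j))                      ∎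
    where
    open ≡-Reasoning
    positive-i : ∀ i → i < suc n → ¬ i ≡ 0 → Σ≤ k (λ j → X i j * F (n ∸ i) (k ∸ j)) ≡ 0ℚ
    positive-i i _ i≢0 = trans (Σ≤≡Σ< k (λ j → X i j * F (n ∸ i) (k ∸ j))) (Σ<-zero (suc k) (λ j _ →
      trans (cong (_* F (n ∸ i) (k ∸ j)) (trans (X≡ i j) (δ-distinct-* i 0 (x j) i≢0))) (ℚₚ.*-zeroˡ (F (n ∸ i) (k ∸ j)))))

  Σ<-δ0 : ∀ k (G : ℕ → ℚ) → Σ< (suc k) (λ j → δ j 0 * G j) ≡ G 0
  Σ<-δ0 k G = trans (Σ<-single (suc k) 0 z<s (λ j _ j≢0 → δ-distinct-* j 0 (G j) j≢0)) (ℚₚ.*-identityˡ (G 0))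

  Σ<-δ1 : ∀ k F n → Σ< (suc k) (λ j → δ j 1 * F n (k ∸ j)) ≡ timesU F n k
  Σ<-δ1 zero    F n = trans (ℚₚ.+-identityʳ _) (ℚₚ.*-zeroˡ (F n 0))
  Σ<-δ1 (suc k) F n = trans (Σ<-single (suc (suc k)) 1 (s≤s z<s) (λ j _ j≢1 → δ-distinct-* j 1 (F n (suc k ∸ j)) j≢1))
                            (ℚₚ.*-identityˡ (F n k))

  u-⊗ : ∀ F n k → (uS ⊗ F) n k ≡ timesU F n k
  u-⊗ F n k = trans (⊗-z-free uS (λ j → δ j 1) F n k (λ i j → refl)) (Σ<-δ1 k F n)

  one+u-⊗ : ∀ F n k → ((oneS ⊕ uS) ⊗ F) n k ≡ F n k + timesU F n k
  one+u-⊗ F n k = begin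
    ((oneS ⊕ uS) ⊗ F) n k                                         ≡⟨ ⊗-z-free (oneS ⊕ uS) (λ j → δ j 0 + δ j 1) F n k
                                                                        (λ i j → sym (ℚₚ.*-distribˡ-+ (δ i 0) (δ j 0) (δ j 1))) ⟩
    Σ< (suc k) (λ j → (δ j 0 + δ j 1) * F n (k ∸ j))              ≡⟨ Σ<-cong (suc k) (λ j _ → ℚₚ.*-distribʳ-+ (F n (k ∸ j)) (δ j 0) (δ j 1)) ⟩
    Σ< (suc k) (λ j → δ j 0 * F n (k ∸ j) + δ j 1 * F n (k ∸ j))  ≡⟨ Σ<-+ (suc k) (λ j → δ j 0 * F n (k ∸ j)) (λ j → δ j 1 * F n (k ∸ j)) ⟩
    Σ< (suc k) (λ j → δ j 0 * F n (k ∸ j)) + Σ< (suc k) (λ j → δ j 1 * F n (k ∸ j))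
                                                                  ≡⟨ cong₂ _+_ (Σ<-δ0 k (λ j → F n (k ∸ j))) (Σ<-δ1 k F n) ⟩
    F n k + timesU F n k                                          ∎
    where open ≡-Reasoning

  diagonal : ℕ → Series
  diagonal j n k = δ (k ℕ.+ j) n * lgPow j n

  δ-shift : ∀ m p q j → δ (p ℕ.+ j) q ≡ δ (m ℕ.+ p ℕ.+ suc j) (suc m ℕ.+ q)
  δ-shift m p q j = δ-cong _ _ _ _ (λ e → trans reassoc (cong (λ z → suc (m ℕ.+ z)) e))
                                   (λ e → ℕₚ.+-cancelˡ-≡ m _ _ (ℕₚ.suc-injective (trans (sym reassoc) e)))
    where
    reassoc : m ℕ.+ p ℕ.+ suc j ≡ suc (m ℕ.+ (p ℕ.+ j))
    reassoc = trans (ℕₚ.+-assoc m p (suc j)) (trans (cong (m ℕ.+_) (ℕₚ.+-suc p j)) (ℕₚ.+-suc m (p ℕ.+ j)))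

  -- One summand (fixed z-degree i ≤ n of the logS factor) of logS ⊗ diagonal j.
  logS-times-diagonal : ∀ j n k i → i ≤ n →
    Σ< (suc k) (λ l → logS i l * diagonal j (n ∸ i) (k ∸ l)) ≡ δ (k ℕ.+ suc j) n * (lg i * lgPow j (n ∸ i))
  logS-times-diagonal j n k zero _ = begin
    Σ< (suc k) (λ l → 0ℚ * diagonal j n (k ∸ l)) ≡⟨ Σ<-zero (suc k) (λ l _ → ℚₚ.*-zeroˡ (diagonal j n (k ∸ l))) ⟩
    0ℚ                                           ≡⟨ ℚₚ.*-zeroʳ (δ (k ℕ.+ suc j) n) ⟨
    δ (k ℕ.+ suc j) n * 0ℚ                       ≡⟨ cong (δ (k ℕ.+ suc j) n *_) (ℚₚ.*-zeroˡ (lgPow j n)) ⟨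
    δ (k ℕ.+ suc j) n * (0ℚ * lgPow j n)         ∎
    where open ≡-Reasoning
  logS-times-diagonal j n k (suc m) m<n with m ℕ.≤? k
  ... | yes m≤k = trans (Σ<-single (suc k) m (s≤s m≤k) (λ l _ l≢m → others l l≢m)) diagonal-term
    where
    d = δ (k ℕ.+ suc j) n
    x = lgPow j (n ∸ suc m)
    others : ∀ l → ¬ l ≡ m → logS (suc m) l * diagonal j (n ∸ suc m) (k ∸ l) ≡ 0ℚ
    others l l≢m = trans (cong (_* diagonal j (n ∸ suc m) (k ∸ l)) (δ-distinct-* l m (lg (suc m)) l≢m))
                         (ℚₚ.*-zeroˡ (diagonal j (n ∸ suc m) (k ∸ l)))
    diagonal-term : logS (suc m) m * diagonal j (n ∸ suc m) (k ∸ m) ≡ d * (lg (suc m) * x)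
    diagonal-term rewrite δ-refl m
                        | δ-shift m (k ∸ m) (n ∸ suc m) j | ℕₚ.m+[n∸m]≡n m≤k | ℕₚ.m+[n∸m]≡n m<n =
      solve 3 (λ a d x → (con 1ℚ :* a) :* (d :* x) := d :* (a :* x)) refl (lg (suc m)) d x
      where open ℚ-Solver
  ... | no m≰k = trans (Σ<-zero (suc k) vanishing) (sym off-diagonal)
    where
    vanishing : ∀ l → l < suc k → logS (suc m) l * diagonal j (n ∸ suc m) (k ∸ l) ≡ 0ℚ
    vanishing l l≤k = trans (cong (_* diagonal j (n ∸ suc m) (k ∸ l)) (δ-distinct-* l m (lg (suc m)) λ { refl → m≰k (ℕₚ.≤-pred l≤k) }))
                            (ℚₚ.*-zeroˡ (diagonal j (n ∸ suc m) (k ∸ l)))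
    -- on the diagonal n = k + j + 1, the degree n - m - 1 is below j
    off-diagonal : δ (k ℕ.+ suc j) n * (lg (suc m) * lgPow j (n ∸ suc m)) ≡ 0ℚ
    off-diagonal with (k ℕ.+ suc j) ℕ.≟ n
    ... | no  k+j+1≢n = δ-distinct-* _ _ _ k+j+1≢n
    ... | yes k+j+1≡n = trans (cong (λ z → δ (k ℕ.+ suc j) n * (lg (suc m) * z)) (lgPow-low j (n ∸ suc m) below))
                              (trans (cong (δ (k ℕ.+ suc j) n *_) (ℚₚ.*-zeroʳ (lg (suc m)))) (ℚₚ.*-zeroʳ (δ (k ℕ.+ suc j) n)))
      where
      below : n ∸ suc m < j
      below = ℕₚ.+-cancelʳ-< (suc m) (n ∸ suc m) j (begin-strict
        n ∸ suc m ℕ.+ suc m   ≡⟨ ℕₚ.m∸n+n≡m m<n ⟩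
        n                     ≡⟨ k+j+1≡n ⟨
        k ℕ.+ suc j           ≡⟨ ℕₚ.+-suc k j ⟩
        suc k ℕ.+ j           ≤⟨ ℕₚ.+-monoˡ-≤ j (ℕₚ.≰⇒> m≰k) ⟩
        m ℕ.+ j               <⟨ ℕₚ.n<1+n (m ℕ.+ j) ⟩
        suc m ℕ.+ j           ≡⟨ ℕₚ.+-comm (suc m) j ⟩
        j ℕ.+ suc m           ∎)
        where open ℕₚ.≤-Reasoning

  logS-power : ∀ j n k → (logS ^S j) n k ≡ diagonal j n k
  logS-power zero    zero    k rewrite ℕₚ.+-identityʳ k = ℚₚ.*-comm (δ 0 0) (δ k 0)
  logS-power zero    (suc n) k rewrite ℕₚ.+-identityʳ k = trans (ℚₚ.*-zeroˡ (δ k 0)) (sym (ℚₚ.*-zeroʳ (δ k (suc n))))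
  logS-power (suc j) n k = begin
    Σ≤ n (λ i → Σ≤ k (λ l → logS i l * (logS ^S j) (n ∸ i) (k ∸ l)))       ≡⟨ Σ≤≡Σ< n (λ i → Σ≤ k (λ l → logS i l * (logS ^S j) (n ∸ i) (k ∸ l))) ⟩
    Σ< (suc n) (λ i → Σ≤ k (λ l → logS i l * (logS ^S j) (n ∸ i) (k ∸ l))) ≡⟨ Σ<-cong (suc n) summand ⟩
    Σ< (suc n) (λ i → δ (k ℕ.+ suc j) n * (lg i * lgPow j (n ∸ i)))         ≡⟨ Σ<-* (suc n) (δ (k ℕ.+ suc j) n) (λ i → lg i * lgPow j (n ∸ i)) ⟩
    δ (k ℕ.+ suc j) n * lgPow (suc j) n                                     ∎
    where
    open ≡-Reasoning
    summand : ∀ i → i < suc n → Σ≤ k (λ l → logS i l * (logS ^S j) (n ∸ i) (k ∸ l)) ≡ δ (k ℕ.+ suc j) n * (lg i * lgPow j (n ∸ i))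
    summand i i≤n = begin
      Σ≤ k (λ l → logS i l * (logS ^S j) (n ∸ i) (k ∸ l))       ≡⟨ Σ≤≡Σ< k (λ l → logS i l * (logS ^S j) (n ∸ i) (k ∸ l)) ⟩
      Σ< (suc k) (λ l → logS i l * (logS ^S j) (n ∸ i) (k ∸ l)) ≡⟨ Σ<-cong (suc k) (λ l _ → cong (logS i l *_) (logS-power j (n ∸ i) (k ∸ l))) ⟩
      Σ< (suc k) (λ l → logS i l * diagonal j (n ∸ i) (k ∸ l))  ≡⟨ logS-times-diagonal j n k i (ℕₚ.≤-pred i≤n) ⟩
      δ (k ℕ.+ suc j) n * (lg i * lgPow j (n ∸ i))              ∎

  powS-sum : ∀ n k → powS n k ≡ Σ< (suc n) (λ j → invFact j * diagonal j n k)
  powS-sum n k = trans (Σ≤≡Σ< n (λ j → invFact j * (logS ^S j) n k))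
                       (Σ<-cong (suc n) (λ j _ → cong (invFact j *_) (logS-power j n k)))

  off-diagonal-term : ∀ j n k → ¬ k ℕ.+ j ≡ n → invFact j * diagonal j n k ≡ 0ℚ
  off-diagonal-term j n k off = trans (cong (invFact j *_) (δ-distinct-* (k ℕ.+ j) n (lgPow j n) off)) (ℚₚ.*-zeroʳ (invFact j))

  powS-low : ∀ n k → k ≤ n → powS n k ≡ invFact (n ∸ k) * lgPow (n ∸ k) n
  powS-low n k k≤n = trans (powS-sum n k) (trans (Σ<-single (suc n) (n ∸ k) (s≤s (ℕₚ.m∸n≤m n k)) others) on-diagonal)
    where
    others : ∀ j → j < suc n → ¬ j ≡ n ∸ k → invFact j * diagonal j n k ≡ 0ℚ
    others j _ j≢n-k = off-diagonal-term j n k (λ k+j≡n → j≢n-k (trans (sym (ℕₚ.m+n∸m≡n k j)) (cong (_∸ k) k+j≡n)))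
    on-diagonal : invFact (n ∸ k) * diagonal (n ∸ k) n k ≡ invFact (n ∸ k) * lgPow (n ∸ k) n
    on-diagonal rewrite ℕₚ.m+[n∸m]≡n k≤n | δ-refl n = cong (invFact (n ∸ k) *_) (ℚₚ.*-identityˡ (lgPow (n ∸ k) n))

  powS-high : ∀ n k → n < k → powS n k ≡ 0ℚ
  powS-high n k n<k = trans (powS-sum n k) (Σ<-zero (suc n) (λ j _ →
    off-diagonal-term j n k (λ k+j≡n → ℕₚ.<-irrefl (sym k+j≡n) (ℕₚ.<-≤-trans n<k (ℕₚ.m≤m+n k j)))))

  powS-stirling : ∀ n k → k ≤ n → powS n k * ι (n !) ≡ ι (stirling n (n ∸ k))
  powS-stirling n k k≤n = begin
    powS n k * ι (n !)                    ≡⟨ cong (_* ι (n !)) (powS-low n k k≤n) ⟩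
    (invFact j * lgPow j n) * ι (n !)     ≡⟨ ℚₚ.*-assoc (invFact j) (lgPow j n) (ι (n !)) ⟩
    invFact j * (lgPow j n * ι (n !))     ≡⟨ cong (invFact j *_) (lgPow-stirling n j) ⟩
    invFact j * (ι (j !) * ι (stirling n j)) ≡⟨ ℚₚ.*-assoc (invFact j) (ι (j !)) (ι (stirling n j)) ⟨
    (invFact j * ι (j !)) * ι (stirling n j) ≡⟨ cong (_* ι (stirling n j)) (invFact-inverse j) ⟩
    1ℚ * ι (stirling n j)                 ≡⟨ ℚₚ.*-identityˡ (ι (stirling n j)) ⟩
    ι (stirling n j)                      ∎
    where
    open ≡-Reasoning
    j = n ∸ k

  -- stirlingᶜ n k = stirling n (n - k), the number of permutations of n
  -- elements with n - k cycles, given by its own recurrence in n.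
  stirlingᶜ : ℕ → ℕ → ℕ
  stirlingᶜ zero    zero    = 1
  stirlingᶜ zero    (suc k) = 0
  stirlingᶜ (suc n) zero    = stirlingᶜ n zero
  stirlingᶜ (suc n) (suc k) = stirlingᶜ n (suc k) ℕ.+ n ℕ.* stirlingᶜ n k

  stirlingᶜ-zero : ∀ n → stirlingᶜ n 0 ≡ 1
  stirlingᶜ-zero zero    = refl
  stirlingᶜ-zero (suc n) = stirlingᶜ-zero n

  stirlingᶜ-high : ∀ n k → n < k → stirlingᶜ n k ≡ 0
  stirlingᶜ-high zero    (suc k) _         = refl
  stirlingᶜ-high (suc n) (suc k) (s≤s n<k)
    rewrite stirlingᶜ-high n (suc k) (ℕₚ.m<n⇒m<1+n n<k) | stirlingᶜ-high n k n<k = ℕₚ.*-zeroʳ n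

  stirling-high : ∀ n j → n < j → stirling n j ≡ 0
  stirling-high zero    (suc j) _         = refl
  stirling-high (suc n) (suc j) (s≤s n<j)
    rewrite stirling-high n (suc j) (ℕₚ.m<n⇒m<1+n n<j) | stirling-high n j n<j | ℕₚ.*-zeroʳ n = refl

  stirlingᶜ≡stirling : ∀ n k → k ≤ n → stirlingᶜ n k ≡ stirling n (n ∸ k)
  stirlingᶜ≡stirling zero    zero    _ = refl
  stirlingᶜ≡stirling (suc n) zero    _
    rewrite stirlingᶜ≡stirling n zero z≤n | stirling-high n (suc n) (ℕₚ.n<1+n n) | ℕₚ.*-zeroʳ n = refl
  stirlingᶜ≡stirling (suc n) (suc k) (s≤s k≤n) with k ℕ.≟ n
  ... | yes refl rewrite stirlingᶜ-high k (suc k) (ℕₚ.n<1+n k) | stirlingᶜ≡stirling k k k≤n | ℕₚ.n∸n≡0 k = no-cycles k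
    where
    no-cycles : ∀ n → n ℕ.* stirling n 0 ≡ 0
    no-cycles zero    = refl
    no-cycles (suc n) = ℕₚ.*-zeroʳ (suc n)
  ... | no k≢n rewrite ℕₚ.+-∸-assoc 1 (ℕₚ.≤∧≢⇒< k≤n k≢n)
                     | stirlingᶜ≡stirling n (suc k) (ℕₚ.≤∧≢⇒< k≤n k≢n) | stirlingᶜ≡stirling n k k≤n
                     | ℕₚ.+-∸-assoc 1 (ℕₚ.≤∧≢⇒< k≤n k≢n) =
    ℕₚ.+-comm (stirling n (n ∸ suc k)) (n ℕ.* stirling n (suc (n ∸ suc k)))

  powS-stirlingᶜ : ∀ n k → powS n k * ι (n !) ≡ ι (stirlingᶜ n k)
  powS-stirlingᶜ n k with k ℕ.≤? n
  ... | yes k≤n = trans (powS-stirling n k k≤n) (cong ι (sym (stirlingᶜ≡stirling n k k≤n)))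
  ... | no  k≰n rewrite powS-high n k (ℕₚ.≰⇒> k≰n) | stirlingᶜ-high n k (ℕₚ.≰⇒> k≰n) = ℚₚ.*-zeroˡ (ι (n !))

module Coefficients (t : ℕ → ℕ → ℕ) (count : (n k : ℕ) → SIS n k ↔ Fin (t n k)) where
  open TreeCounting using (module TreeCount)
  open FiniteSums using (ι; ι-+; /-*-cancel; *ι-cancel)
  open BivariateSeries using (timesU; stirlingᶜ; stirlingᶜ-zero; powS-stirlingᶜ)
  open import Data.Nat as ℕ using (zero; suc; _<_; s≤s; _!; _≤ᵇ_)
  import Data.Nat.Properties as ℕₚ
  open import Data.Rational using (0ℚ; _+_; _*_; -_)
  import Data.Rational.Properties as ℚₚ
  open import Data.Bool using (true; false; T)
  open import Relation.Binary.PropositionalEquality using (refl; sym; trans; cong; cong₂; subst; module ≡-Reasoning)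

  open TreeCount t count

  t-high : ∀ m k → m < k → t (suc m) k ≡ 0
  t-high zero    (suc k) _
    rewrite t-recurrence 0 k | t-zero-leaves (suc k) = refl
  t-high (suc m) (suc k) (s≤s m<k)
    rewrite t-recurrence (suc m) k | t-high m (suc k) (ℕₚ.m<n⇒m<1+n m<k) | t-high m k m<k = ℕₚ.*-zeroʳ (suc m)

  t-one-internal : ∀ n → t (suc (suc n)) 1 ≡ 1
  t-one-internal zero    rewrite t-recurrence 1 0 | t-recurrence 0 0 | t-zero-leaves 1 | t-single-leaf = refl
  t-one-internal (suc n) rewrite t-recurrence (suc (suc n)) 0 | t-one-internal n | t-no-internal n = cong suc (ℕₚ.*-zeroʳ n)

  t-adjacent : ∀ N k → t (suc N) (suc k) ℕ.+ t (suc N) k ≡ stirlingᶜ (suc N) k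
  t-adjacent zero    zero    rewrite t-recurrence 0 0 | t-zero-leaves 1 | t-single-leaf = refl
  t-adjacent zero    (suc k) rewrite t-recurrence 0 (suc k) | t-recurrence 0 k | t-zero-leaves (suc (suc k)) | t-zero-leaves (suc k) = refl
  t-adjacent (suc N) zero    rewrite t-one-internal N | t-no-internal N | stirlingᶜ-zero N = refl
  t-adjacent (suc N) (suc k) rewrite t-recurrence (suc N) (suc k) | t-recurrence (suc N) k = begin
    (a ℕ.+ suc N ℕ.* b) ℕ.+ (b ℕ.+ suc N ℕ.* c) ≡⟨ regroup a b c (suc N) ⟩
    (a ℕ.+ b) ℕ.+ suc N ℕ.* (b ℕ.+ c)           ≡⟨ cong₂ (λ x y → x ℕ.+ suc N ℕ.* y) (t-adjacent N (suc k)) (t-adjacent N k) ⟩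
    stirlingᶜ (suc N) (suc k) ℕ.+ suc N ℕ.* stirlingᶜ (suc N) k ∎
    where
    open ≡-Reasoning
    open import Data.Nat.Solver using (module +-*-Solver)
    open +-*-Solver
    a = t (suc N) (suc (suc k))
    b = t (suc N) (suc k)
    c = t (suc N) k
    regroup : ∀ a b c n → (a ℕ.+ n ℕ.* b) ℕ.+ (b ℕ.+ n ℕ.* c) ≡ (a ℕ.+ b) ℕ.+ n ℕ.* (b ℕ.+ c)
    regroup = solve 4 (λ a b c n → (a :+ n :* b) :+ (b :+ n :* c) := (a :+ b) :+ n :* (b :+ c)) refl

  E : Series
  E = egf t

  egf-coefficient : ∀ m k → E (suc m) k * ι (suc m !) ≡ ι (t (suc m) k)
  egf-coefficient m k with k ≤ᵇ m in e
  ... | true  = /-*-cancel (t (suc m) k) (suc m !) {{suc m ℕₚ.!≢0}}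
  ... | false = trans (ℚₚ.*-zeroˡ (ι (suc m !))) (cong ι (sym (t-high m k (ℕₚ.≰⇒> (λ k≤m → subst T e (ℕₚ.≤⇒≤ᵇ k≤m))))))

  egf-no-internal : ∀ m → E (suc (suc m)) 0 ≡ 0ℚ
  egf-no-internal m rewrite t-no-internal m = ℚₚ.0/n≡0 (suc (suc m) !) {{suc (suc m) ℕₚ.!≢0}}

  egf-powS : ∀ m k → E (suc m) (suc k) + E (suc m) k ≡ powS (suc m) k
  egf-powS m k = *ι-cancel _ _ (suc m !) {{suc m ℕₚ.!≢0}} (begin
    (E (suc m) (suc k) + E (suc m) k) * ι (suc m !)               ≡⟨ ℚₚ.*-distribʳ-+ (ι (suc m !)) (E (suc m) (suc k)) (E (suc m) k) ⟩
    E (suc m) (suc k) * ι (suc m !) + E (suc m) k * ι (suc m !)   ≡⟨ cong₂ _+_ (egf-coefficient m (suc k)) (egf-coefficient m k) ⟩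
    ι (t (suc m) (suc k)) + ι (t (suc m) k)                       ≡⟨ ι-+ (t (suc m) (suc k)) (t (suc m) k) ⟨
    ι (t (suc m) (suc k) ℕ.+ t (suc m) k)                         ≡⟨ cong ι (t-adjacent m k) ⟩
    ι (stirlingᶜ (suc m) k)                                       ≡⟨ powS-stirlingᶜ (suc m) k ⟨
    powS (suc m) k * ι (suc m !)                                  ∎)
    where open ≡-Reasoning

  coefficients : ∀ n k → E n k + timesU E n k ≡ (timesU powS n k + - uS n k) + zS n k
  coefficients zero          zero          = refl
  coefficients zero          (suc zero)    = refl
  coefficients zero          (suc (suc k)) = refl
  coefficients (suc zero)    zero          rewrite t-single-leaf = refl
  coefficients (suc (suc m)) zero          rewrite egf-no-internal m = refl
  coefficients (suc m)       (suc k)       = begin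
    E (suc m) (suc k) + E (suc m) k        ≡⟨ egf-powS m k ⟩
    powS (suc m) k                         ≡⟨ ℚₚ.+-identityʳ (powS (suc m) k) ⟨
    powS (suc m) k + 0ℚ                    ≡⟨ ℚₚ.+-identityʳ _ ⟨
    (powS (suc m) k + 0ℚ) + 0ℚ             ≡⟨ cong₂ (λ a b → (powS (suc m) k + - a) + b) (ℚₚ.*-zeroˡ (δ (suc k) 1)) (ℚₚ.*-zeroʳ (δ (suc m) 1)) ⟨
    (powS (suc m) k + - uS (suc m) (suc k)) + zS (suc m) (suc k) ∎
    where open ≡-Reasoning

open BivariateSeries using (timesU; one+u-⊗; u-⊗)
open import Data.Rational using (_+_; -_)
open import Relation.Binary.PropositionalEquality using (cong; module ≡-Reasoning)

proposition1 : (t : ℕ → ℕ → ℕ) →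
    ((n k : ℕ) → SIS n k ↔ Fin (t n k)) →
    (n k : ℕ) →
      ((oneS ⊕ uS) ⊗ egf t) n k ≡ (((uS ⊗ powS) ⊖ uS) ⊕ zS) n k
proposition1 t count n k = begin
  ((oneS ⊕ uS) ⊗ egf t) n k                           ≡⟨ one+u-⊗ (egf t) n k ⟩
  egf t n k + timesU (egf t) n k                      ≡⟨ Coefficients.coefficients t count n k ⟩
  (timesU powS n k + - uS n k) + zS n k               ≡⟨ cong (λ x → (x + - uS n k) + zS n k) (u-⊗ powS n k) ⟨
  (((uS ⊗ powS) ⊖ uS) ⊕ zS) n k                       ∎
  where open ≡-Reasoning
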